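{- Let $\sigma,k\ge2$ and $\pi,\rho\in\mathbb{U}_{\sigma,k}$ be such that the $k$-mer $\rho[1]$ has no periods. Then (i) if $\pi[1]$ has a period, then $\rho\triangleleft\pi$; (ii) if $\pi[1]$ has no periods, then $C_{\mathcal{S}_{\pi,1}}(n)=C_{\mathcal{S}_{\rho,1}}(n)$ for all $n$.
   Context: $\Sigma=\{0,\dots,\sigma-1\}$; a $k$-mer is a string of length $k$. An integer $p$ with $1\le p<|s|$ is a period of $s$ if $s[1..|s|-p]=s[p+1..|s|]$. An arrangement of $\Sigma^k$ is a sequence $\rho$ of distinct $k$-mers ($\rho[j]$ has rank $j$); its domain is the set of entries. The domain $U$ is a universal hitting set (UHS) for $w$ if every string of length $w+k-1$ contains a $k$-mer of $U$; $\mathbb{U}_{\sigma,k}$ is the set of arrangements whose domain is a UHS for some $w$. For $\rho$ whose domain is a UHS for $w$, the minimizer $(\rho,w)$ selects, in each length-$(w+k-1)$ window of a string, the starting position of the leftmost occurrence of the minimum-rank domain $k$-mer in the window; its density $d_{(\rho,w)}$ is the limiting expected fraction of selected positions in a uniformly random string (equivalently, the fraction of $v\in\Sigma^{w+k}$ whose minimum-rank $k$-mer is its length-$k$ prefix or its length-$k$ suffix occurring only once in $v$). $\rho\triangleleft\rho'$ means there is $w_0$ with $d_{(\rho,w)}<d_{(\rho',w)}$ for all $w\ge w_0$. $\mathcal{S}_{\rho,1}$ is the set of strings of length $\ge k$ whose length-$k$ suffix is $\rho[1]$ and which contain no other occurrence of $\rho[1]$; $C_L(n)=|L\cap\Sigma^n|$.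 -}

module Defs where

open import Data.Bool using (Bool; true; false; if_then_else_; _∨_; _∧_)
open import Data.Nat using (ℕ; zero; suc; _+_; _∸_; _^_; _≤_; _<ᵇ_; _≤ᵇ_; _≡ᵇ_)
open import Data.Nat.Properties using (m^n≢0)
open import Data.Fin using (Fin)
import Data.Fin as Fin
open import Data.List using (List; []; _∷_; length; take; drop; filter; filterᵇ; map; concatMap; allFin)
open import Data.List.Properties using (≡-dec)
open import Data.List.Relation.Unary.Any using (Any)
open import Data.List.Relation.Unary.Unique.Propositional using (Unique)
open import Data.List.Membership.Propositional using (_∈_)
open import Data.Vec using (Vec; toList)
open import Data.Maybe using (Maybe; just; nothing)
open import Data.Product using (Σ; _×_; ∃-syntax)
open import Data.Integer using (+_)
open import Data.Rational using (ℚ; 0ℚ; _/_) renaming (_<_ to _<ℚ_)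
open import Relation.Binary.PropositionalEquality using (_≡_)
open import Relation.Nullary using (⌊_⌋)

Word : ℕ → Set
Word σ = List (Fin σ)

Kmer : ℕ → ℕ → Set
Kmer σ k = Vec (Fin σ) k

-- An arrangement: a list of k-mers (position j ↦ rank j+1); distinctness
-- is imposed separately (IsArrangement).
Arrangement : ℕ → ℕ → Set
Arrangement σ k = List (Kmer σ k)

IsArrangement : ∀ {σ k} → Arrangement σ k → Set
IsArrangement ρ = Unique ρ

_≟w_ : ∀ {σ} → (u v : Word σ) → _
_≟w_ = ≡-dec Fin._≟_

windows : ∀ {σ} → ℕ → Word σ → List (Word σ)
windows zero    []       = [] ∷ []
windows (suc k) []       = []
windows k (x ∷ xs) = if k ≤ᵇ length (x ∷ xs) then take k (x ∷ xs) ∷ windows k xs else []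

countEq : ∀ {σ} → Word σ → List (Word σ) → ℕ
countEq x ws = length (filter (x ≟w_) ws)

allWords : (σ n : ℕ) → List (Word σ)
allWords σ zero    = [] ∷ []
allWords σ (suc n) = concatMap (λ x → map (x ∷_) (allWords σ n)) (allFin σ)

IsPeriod : ∀ {σ} → Word σ → ℕ → Set
IsPeriod s p = (1 ≤ p) × (suc p ≤ length s) × (take (length s ∸ p) s ≡ drop p s)

HasPeriod : ∀ {σ k} → Kmer σ k → Set
HasPeriod r = Σ ℕ (IsPeriod (toList r))

IsUHS : ∀ {σ k} → Arrangement σ k → ℕ → Set
IsUHS {σ} {k} ρ w = (1 ≤ w) × ((s : Word σ) → length s ≡ w + k ∸ 1 →
                      Any (λ x → x ∈ map toList ρ) (windows k s))

InU : ∀ {σ k} → Arrangement σ k → Set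
InU ρ = IsArrangement ρ × ∃[ w ] IsUHS ρ w

minKmer : ∀ {σ k} → Arrangement σ k → Word σ → Maybe (Word σ)
minKmer         []      v = nothing
minKmer {k = k} (r ∷ ρ) v =
  if 0 <ᵇ countEq (toList r) (windows k v) then just (toList r) else minKmer ρ v

chargedAt : ∀ {σ} → ℕ → Word σ → Maybe (Word σ) → Bool
chargedAt k v nothing  = false
chargedAt k v (just m) =
  ⌊ m ≟w take k v ⌋ ∨ (⌊ m ≟w drop (length v ∸ k) v ⌋ ∧ (countEq m (windows k v) ≡ᵇ 1))

charged : ∀ {σ k} → Arrangement σ k → Word σ → Bool
charged {k = k} ρ v = chargedAt k v (minKmer ρ v)

density : ∀ {σ k} → Arrangement σ k → ℕ → ℚ
density {zero}  {k} ρ w = 0ℚ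
density {suc s} {k} ρ w =
  _/_ (+ length (filterᵇ (charged ρ) (allWords (suc s) (w + k))))
      (suc s ^ (w + k)) {{m^n≢0 (suc s) (w + k)}}

_◁_ : ∀ {σ k} → Arrangement σ k → Arrangement σ k → Set
ρ ◁ ρ' = ∃[ w₀ ] (∀ w → w₀ ≤ w → density ρ w <ℚ density ρ' w)

inS : ∀ {σ k} → Kmer σ k → Word σ → Bool
inS {k = k} r v = (k ≤ᵇ length v) ∧ (⌊ drop (length v ∸ k) v ≟w toList r ⌋
                  ∧ (countEq (toList r) (windows k v) ≡ᵇ 1))

CS : ∀ {σ k} → Kmer σ k → ℕ → ℕ
CS {σ} r n = length (filterᵇ (inS r) (allWords σ n))

{-# OPTIONS --safe #-}
module Submission where

-- Write A_x(n) for the number of strings of length n avoiding the k-mer x, and S_x(n) for the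
-- number of those of length n whose only occurrence of x is a suffix (so S_r(n) = C_{S_ρ,1}(n)
-- when r = ρ[1]).  Appending a letter to a string avoiding x either keeps it avoiding or creates
-- a sole final occurrence, so A_x(n+1) + S_x(n+1) = σ A_x(n).  If x has no period, the strings
-- counted by S_x(n+k) are exactly the avoiding strings of length n followed by x, so
-- S_x(n+k) = A_x(n); the two recurrences determine A_x and S_x from σ and k, which is (ii).
--
-- For (i), a string of length w+k charged by ρ starts with r, ends with a sole occurrence of r,
-- or avoids r, so there are at most σ^w + S_r(w+k) + A_r(w+k) of them, while π charges at least
-- the σ^w + S_p(w+k) strings that start with p or end with a sole p.  A period q of p lets a final
-- p overlap the previous one, which gives S_p(n+q+k) + S_p(n+k) ≤ A_p(n+q).  In the recurrence
-- for A_p this acts as a delayed damping term of weight σ^q/(σ^q+1) < 1, against weight 1 for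
-- A_r, and it forces A_p/A_r → ∞.  Since padding gives S_p(n+2k) ≥ A_p(n), π eventually charges
-- more strings than ρ.

open import Data.Bool using (Bool; true; false; T; _∨_; _∧_; if_then_else_)
open import Data.Bool.Properties using (∨-identityʳ; ∨-zeroʳ; ∧-zeroʳ; T-∧; T-≡)
open import Data.Empty using (⊥; ⊥-elim)
open import Data.Fin using (Fin)
import Data.Fin as Fin
import Data.Integer as ℤ
import Data.Integer.Properties as ℤ
open import Data.List using (List; []; _∷_; _++_; [_]; _∷ʳ_; initLast; _∷ʳ′_; length; take; drop; map; filterᵇ; concatMap; allFin; reverse; replicate; head)
open import Data.List.Properties
open import Data.List.Membership.Propositional using (_∈_; find)
open import Data.List.Membership.Propositional.Properties
open import Data.List.Relation.Unary.All as All using (All; []; _∷_)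
import Data.List.Relation.Unary.All.Properties as All
open import Data.List.Relation.Unary.AllPairs using ([]; _∷_)
open import Data.List.Relation.Unary.Any as Any using (here; there)
open import Data.List.Relation.Unary.Unique.Propositional using (Unique)
import Data.List.Relation.Unary.Unique.Propositional.Properties as Unique
open import Data.Maybe using (just)
open import Data.Nat
open import Data.Nat.Induction using (<-rec)
open import Data.Nat.Properties
open import Data.Nat.Tactic.RingSolver using (solve-∀)
open import Data.Product using (Σ; _×_; _,_; proj₁; proj₂; ∃; ∃₂)
import Data.Rational as ℚ
import Data.Rational.Properties as ℚ
import Data.Rational.Unnormalised as ℚᵘ
import Data.Rational.Unnormalised.Properties as ℚᵘ
open import Data.Sum using (_⊎_; inj₁; inj₂)
import Data.Sum as Sum
open import Data.Unit using (tt)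
open import Data.Vec using (toList)
open import Data.Vec.Properties using (length-toList)
open import Function using (_∘_; case_of_; Equivalence)
open import Relation.Binary.PropositionalEquality using (_≡_; _≢_; refl; sym; trans; cong; cong₂; subst; subst₂; module ≡-Reasoning)
open import Relation.Nullary using (¬_; yes; no; ⌊_⌋; contradiction)
open import Relation.Nullary.Decidable using (T?)

open import Defs

T⇒≡true : ∀ {b} → T b → b ≡ true
T⇒≡true = Equivalence.to T-≡

≡true⇒T : ∀ {b} → b ≡ true → T b
≡true⇒T = Equivalence.from T-≡

≤⇒≤ᵇ≡true : ∀ {m n} → m ≤ n → (m ≤ᵇ n) ≡ true
≤⇒≤ᵇ≡true m≤n = T⇒≡true (≤⇒≤ᵇ m≤n)

>⇒≤ᵇ≡false : ∀ {m n} → n < m → (m ≤ᵇ n) ≡ false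
>⇒≤ᵇ≡false {m} {n} n<m with m ≤ᵇ n in eq
... | true  = ⊥-elim (<⇒≱ n<m (≤ᵇ⇒≤ m n (≡true⇒T eq)))
... | false = refl

length-∷ʳ : ∀ {A : Set} (xs : List A) (x : A) → length (xs ∷ʳ x) ≡ suc (length xs)
length-∷ʳ xs x = trans (length-++ xs) (+-comm (length xs) 1)

length-take-≤ : ∀ {A : Set} n (xs : List A) → n ≤ length xs → length (take n xs) ≡ n
length-take-≤ n xs n≤ = trans (length-take n xs) (m≤n⇒m⊓n≡m n≤)

take-length-++ : ∀ {A : Set} (xs ys : List A) → take (length xs) (xs ++ ys) ≡ xs
take-length-++ [] ys = refl
take-length-++ (x ∷ xs) ys = cong (x ∷_) (take-length-++ xs ys)

take-length-++-+ : ∀ {A : Set} (xs ys : List A) m → take (length xs + m) (xs ++ ys) ≡ xs ++ take m ys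
take-length-++-+ []       ys m = refl
take-length-++-+ (x ∷ xs) ys m = cong (x ∷_) (take-length-++-+ xs ys m)

drop-length-++ : ∀ {A : Set} (xs ys : List A) → drop (length xs) (xs ++ ys) ≡ ys
drop-length-++ [] ys = refl
drop-length-++ (x ∷ xs) ys = drop-length-++ xs ys

take-++ : ∀ {A : Set} n (xs ys : List A) → take n (xs ++ ys) ≡ take n xs ++ take (n ∸ length xs) ys
take-++ zero    []       ys = refl
take-++ zero    (x ∷ xs) ys = refl
take-++ (suc n) []       ys = refl
take-++ (suc n) (x ∷ xs) ys = cong (x ∷_) (take-++ n xs ys)

take-++-≤ : ∀ {A : Set} n (xs ys : List A) → n ≤ length xs → take n (xs ++ ys) ≡ take n xs
take-++-≤ n xs ys n≤ = trans (take-++ n xs ys)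
  (trans (cong (λ i → take n xs ++ take i ys) (m≤n⇒m∸n≡0 n≤)) (++-identityʳ _))

take-++-≥ : ∀ {A : Set} n (xs ys : List A) → length xs ≤ n → take n (xs ++ ys) ≡ xs ++ take (n ∸ length xs) ys
take-++-≥ n xs ys xs≤n = trans (take-++ n xs ys) (cong (_++ take (n ∸ length xs) ys) (take-all n xs xs≤n))

drop-++-≤ : ∀ {A : Set} n (xs ys : List A) → n ≤ length xs → drop n (xs ++ ys) ≡ drop n xs ++ ys
drop-++-≤ zero    xs       ys _         = refl
drop-++-≤ (suc n) (x ∷ xs) ys (s≤s n≤) = drop-++-≤ n xs ys n≤

suffix : ∀ {A : Set} → ℕ → List A → List A
suffix k v = drop (length v ∸ k) v

suffix-exact : ∀ {A : Set} k (v : List A) → length v ≡ k → suffix k v ≡ v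
suffix-exact k v refl = cong (λ i → drop i v) (n∸n≡0 (length v))

suffix-cons : ∀ {A : Set} k (a : A) v → k ≤ length v → suffix k (a ∷ v) ≡ suffix k v
suffix-cons k a v k≤ = cong (λ i → drop i (a ∷ v)) (+-∸-assoc 1 k≤)

suffix-++ : ∀ {A : Set} (x w : List A) → suffix (length w) (x ++ w) ≡ w
suffix-++ x w = trans (cong (λ i → drop (i ∸ length w) (x ++ w)) (length-++ x))
                      (trans (cong (λ i → drop i (x ++ w)) (m+n∸n≡m (length x) (length w))) (drop-length-++ x w))

suffix-of-++ : ∀ {A : Set} (x y t s : List A) → t ++ s ≡ x ++ y → length s ≤ length y →
  ∃ λ t′ → t′ ++ s ≡ y
suffix-of-++ []      y t       s eq  _   = t , eq
suffix-of-++ (a ∷ x) y []      s refl s≤y = contradiction s≤y (<⇒≱ (s≤s (length-++-≤ʳ y {x})))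
suffix-of-++ (a ∷ x) y (b ∷ t) s eq  s≤y = suffix-of-++ x y t s (∷-injectiveʳ eq) s≤y

All-self-overlap : ∀ {A : Set} {P : A → Set} (s w : List A) → 0 < length s → All P s →
  w ≡ take (length w) (s ++ w) → All P w
All-self-overlap s       []      _ _ _ = []
All-self-overlap (b ∷ s) (a ∷ w) _ (Pb ∷ Ps) eq with refl , eq′ ← ∷-injective eq =
  Pb ∷ All-self-overlap (s ∷ʳ a) w (subst (0 <_) (sym (length-∷ʳ s a)) (s≤s z≤n)) (All.∷ʳ⁺ Ps Pb)
         (trans eq′ (cong (take (length w)) (sym (++-assoc s [ a ] w))))

All-≡-∷ʳ : ∀ {A : Set} {c : A} (xs : List A) → 0 < length xs → All (_≡ c) xs → ∃ λ u → xs ≡ u ∷ʳ c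
All-≡-∷ʳ xs xs>0 all-c with initLast xs
... | [] = contradiction xs>0 λ ()
... | u ∷ʳ′ d with refl ← proj₂ (All.∷ʳ⁻ all-c) = u , refl

non-final-letter : ∀ {σ} → 2 ≤ σ → (w : Word σ) → ∃ λ c → ∀ u → w ≢ u ∷ʳ c
non-final-letter {suc (suc _)} (s≤s (s≤s z≤n)) w with initLast w
... | []             = Fin.zero , λ u eq → 0≢1+n (trans (cong length eq) (length-∷ʳ u Fin.zero))
... | u ∷ʳ′ Fin.zero  = Fin.suc Fin.zero , λ u′ eq → case ∷ʳ-injectiveʳ u u′ eq of λ ()
... | u ∷ʳ′ Fin.suc _ = Fin.zero , λ u′ eq → case ∷ʳ-injectiveʳ u u′ eq of λ ()

injection⇒length≤ : ∀ {A B : Set} (f : A → B) {xs : List A} {ys : List B} → Unique xs →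
  (∀ {x} → x ∈ xs → f x ∈ ys) → (∀ {x y} → x ∈ xs → y ∈ xs → f x ≡ f y → x ≡ y) →
  length xs ≤ length ys
injection⇒length≤ f {[]} _ _ _ = z≤n
injection⇒length≤ f {x ∷ xs} (x∉xs ∷ unique) into inj
  with ys₁ , ys₂ , refl ← ∈-∃++ (into (here refl)) = begin
    suc (length xs)              ≤⟨ s≤s (injection⇒length≤ f unique into′ (λ p q → inj (there p) (there q))) ⟩
    suc (length (ys₁ ++ ys₂))    ≡⟨ cong suc (length-++ ys₁) ⟩
    suc (length ys₁ + length ys₂) ≡⟨ +-suc (length ys₁) (length ys₂) ⟨
    length ys₁ + length (f x ∷ ys₂) ≡⟨ length-++ ys₁ ⟨
    length (ys₁ ++ f x ∷ ys₂) ∎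
  where
  open ≤-Reasoning
  into′ : ∀ {y} → y ∈ xs → f y ∈ ys₁ ++ ys₂
  into′ {y} y∈xs with ∈-++⁻ ys₁ (into (there y∈xs))
  ... | inj₁ p        = ∈-++⁺ˡ p
  ... | inj₂ (here e) = ⊥-elim (All.lookup x∉xs y∈xs (sym (inj (there y∈xs) (here refl) e)))
  ... | inj₂ (there p) = ∈-++⁺ʳ ys₁ p

length-filterᵇ-∨-∧ : ∀ {A : Set} (P Q : A → Bool) xs →
  length (filterᵇ (λ v → P v ∨ Q v) xs) + length (filterᵇ (λ v → P v ∧ Q v) xs) ≡
  length (filterᵇ P xs) + length (filterᵇ Q xs)
length-filterᵇ-∨-∧ P Q [] = refl
length-filterᵇ-∨-∧ P Q (x ∷ xs) with P x | Q x
... | true  | true  = cong suc (trans (+-suc _ _) (trans (cong suc (length-filterᵇ-∨-∧ P Q xs)) (sym (+-suc _ _))))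
... | true  | false = cong suc (length-filterᵇ-∨-∧ P Q xs)
... | false | true  = trans (cong suc (length-filterᵇ-∨-∧ P Q xs)) (sym (+-suc _ _))
... | false | false = length-filterᵇ-∨-∧ P Q xs

-- Counting strings of a given length

module _ {σ : ℕ} where

  prepend : List (Word σ) → List (Fin σ) → List (Word σ)
  prepend ws xs = concatMap (λ x → map (x ∷_) ws) xs

  ∈-prepend⁻ : ∀ ws xs {v} → v ∈ prepend ws xs → ∃₂ λ x u → x ∈ xs × u ∈ ws × v ≡ x ∷ u
  ∈-prepend⁻ ws xs v∈ with x , x∈xs , v∈x∷ws ← find (∈-concatMap⁻ (λ x → map (x ∷_) ws) {xs = xs} v∈)
                      with u , u∈ws , refl ← ∈-map⁻ (x ∷_) v∈x∷ws = x , u , x∈xs , u∈ws , refl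

  prepend-unique : ∀ ws xs → Unique ws → Unique xs → Unique (prepend ws xs)
  prepend-unique ws [] _ _ = []
  prepend-unique ws (x ∷ xs) uws (x∉xs ∷ uxs) =
    Unique.++⁺ (Unique.map⁺ (λ { refl → refl }) uws) (prepend-unique ws xs uws uxs) disjoint
    where
    disjoint : ∀ {v} → v ∈ map (x ∷_) ws × v ∈ prepend ws xs → ⊥
    disjoint (p , q) with _ , _ , refl ← ∈-map⁻ (x ∷_) p
                     with _ , _ , y∈xs , _ , refl ← ∈-prepend⁻ ws xs q = All.lookup x∉xs y∈xs refl

  ∈-allWords⁻ : ∀ n {v} → v ∈ allWords σ n → length v ≡ n
  ∈-allWords⁻ zero (here refl) = refl
  ∈-allWords⁻ (suc n) v∈ with _ , _ , _ , u∈ , refl ← ∈-prepend⁻ (allWords σ n) (allFin σ) v∈ =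
    cong suc (∈-allWords⁻ n u∈)

  ∈-allWords⁺ : ∀ n (v : Word σ) → length v ≡ n → v ∈ allWords σ n
  ∈-allWords⁺ zero [] refl = here refl
  ∈-allWords⁺ (suc n) (x ∷ v) refl =
    ∈-concatMap⁺ (λ x → map (x ∷_) (allWords σ n)) {xs = allFin σ}
      (Any.map (λ { refl → ∈-map⁺ (x ∷_) (∈-allWords⁺ n v refl) }) (∈-allFin x))

  allWords-unique : ∀ n → Unique (allWords σ n)
  allWords-unique zero = [] ∷ []
  allWords-unique (suc n) = prepend-unique (allWords σ n) (allFin σ) (allWords-unique n) (Unique.allFin⁺ σ)

  length-allWords : ∀ n → length (allWords σ n) ≡ σ ^ n
  length-allWords zero = refl
  length-allWords (suc n) = trans (length-prepend (allWords σ n) (allFin σ))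
    (cong₂ _*_ (length-tabulate {n = σ} (λ x → x)) (length-allWords n))
    where
    length-prepend : ∀ ws xs → length (prepend ws xs) ≡ length xs * length ws
    length-prepend ws [] = refl
    length-prepend ws (x ∷ xs) =
      trans (length-++ (map (x ∷_) ws)) (cong₂ _+_ (length-map (x ∷_) ws) (length-prepend ws xs))

  IsWord : ℕ → (Word σ → Bool) → Word σ → Set
  IsWord n P v = length v ≡ n × P v ≡ true

  -- Opaque so that unification sees countWords n P rather than its unfolding into filters.
  opaque
    countWords : ℕ → (Word σ → Bool) → ℕ
    countWords n P = length (filterᵇ P (allWords σ n))

    countWords-definition : ∀ n P → countWords n P ≡ length (filterᵇ P (allWords σ n))
    countWords-definition n P = refl

    private
      counted⁻ : ∀ {n P v} → v ∈ filterᵇ P (allWords σ n) → IsWord n P v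
      counted⁻ {n} {P} v∈ with v∈all , Pv ← ∈-filter⁻ (T? ∘ P) v∈ = ∈-allWords⁻ n v∈all , T⇒≡true Pv

      counted⁺ : ∀ {n P v} → IsWord n P v → v ∈ filterᵇ P (allWords σ n)
      counted⁺ {n} {P} {v} (len , Pv) = ∈-filter⁺ (T? ∘ P) (∈-allWords⁺ n v len) (≡true⇒T Pv)

      counted-unique : ∀ n P → Unique (filterᵇ P (allWords σ n))
      counted-unique n P = Unique.filter⁺ (T? ∘ P) (allWords-unique n)

    countWords-injection : ∀ {n m P Q} (f : Word σ → Word σ) →
      (∀ {v} → IsWord n P v → IsWord m Q (f v)) →
      (∀ {u v} → IsWord n P u → IsWord n P v → f u ≡ f v → u ≡ v) →
      countWords n P ≤ countWords m Q
    countWords-injection {n} {m} {P} {Q} f into inj =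
      injection⇒length≤ f (counted-unique n P) (λ v∈ → counted⁺ {m} {Q} (into (counted⁻ v∈)))
        (λ u∈ v∈ → inj (counted⁻ u∈) (counted⁻ v∈))

    countWords-injection₂ : ∀ {n₁ n₂ m P₁ P₂ Q} (f : Word σ → Word σ) → n₁ ≢ n₂ →
      (∀ {v} → IsWord n₁ P₁ v → IsWord m Q (f v)) →
      (∀ {v} → IsWord n₂ P₂ v → IsWord m Q (f v)) →
      (∀ {u v} → IsWord n₁ P₁ u ⊎ IsWord n₂ P₂ u → IsWord n₁ P₁ v ⊎ IsWord n₂ P₂ v →
                 f u ≡ f v → u ≡ v) →
      countWords n₁ P₁ + countWords n₂ P₂ ≤ countWords m Q
    countWords-injection₂ {n₁} {n₂} {m} {P₁} {P₂} {Q} f n₁≢n₂ into₁ into₂ inj =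
      subst (_≤ countWords m Q) (length-++ xs₁)
        (injection⇒length≤ f (Unique.++⁺ (counted-unique n₁ P₁) (counted-unique n₂ P₂) disjoint)
          (λ v∈ → counted⁺ {m} {Q} (Sum.[ into₁ , into₂ ] (source v∈)))
          (λ u∈ v∈ → inj (source u∈) (source v∈)))
      where
      xs₁ xs₂ : List (Word σ)
      xs₁ = filterᵇ P₁ (allWords σ n₁)
      xs₂ = filterᵇ P₂ (allWords σ n₂)
      disjoint : ∀ {v} → v ∈ xs₁ × v ∈ xs₂ → ⊥
      disjoint (p , q) = n₁≢n₂ (trans (sym (proj₁ (counted⁻ p))) (proj₁ (counted⁻ q)))
      source : ∀ {v} → v ∈ xs₁ ++ xs₂ → IsWord n₁ P₁ v ⊎ IsWord n₂ P₂ v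
      source v∈ with ∈-++⁻ xs₁ v∈
      ... | inj₁ p = inj₁ (counted⁻ p)
      ... | inj₂ q = inj₂ (counted⁻ q)

    countWords-none : ∀ {n P} → (∀ v → length v ≡ n → P v ≡ false) → countWords n P ≡ 0
    countWords-none {n} {P} ¬P = cong length (filter-none (T? ∘ P)
      (All.tabulate λ {v} v∈ → subst T (¬P v (∈-allWords⁻ n v∈))))

    countWords-all : ∀ n → countWords n (λ _ → true) ≡ σ ^ n
    countWords-all n = trans (cong length (filter-all (T? ∘ (λ (_ : Word σ) → true)) {xs = allWords σ n}
                               (All.universal (λ _ → tt) _)))
                             (length-allWords n)

    countWords-∨-∧ : ∀ n P Q →
      countWords n (λ v → P v ∨ Q v) + countWords n (λ v → P v ∧ Q v) ≡ countWords n P + countWords n Q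
    countWords-∨-∧ n P Q = length-filterᵇ-∨-∧ P Q (allWords σ n)

    countWords-tail : ∀ n P → countWords (suc n) (P ∘ drop 1) ≡ σ * countWords n P
    countWords-tail n P = trans (count-prepend (allWords σ n) (allFin σ))
                                (cong (_* countWords n P) (length-tabulate {n = σ} (λ x → x)))
      where
      count-map : ∀ x ws → length (filterᵇ (P ∘ drop 1) (map (x ∷_) ws)) ≡ length (filterᵇ P ws)
      count-map x [] = refl
      count-map x (u ∷ ws) with P u
      ... | true  = cong suc (count-map x ws)
      ... | false = count-map x ws
      count-prepend : ∀ ws xs → length (filterᵇ (P ∘ drop 1) (prepend ws xs)) ≡ length xs * length (filterᵇ P ws)
      count-prepend ws [] = refl
      count-prepend ws (x ∷ xs) =
        trans (trans (cong length (filter-++ (T? ∘ (P ∘ drop 1)) (map (x ∷_) ws) (prepend ws xs)))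
                     (length-++ (filterᵇ (P ∘ drop 1) (map (x ∷_) ws))))
              (cong₂ _+_ (count-map x ws) (count-prepend ws xs))

  countWords-mono : ∀ {n P Q} → (∀ {v} → length v ≡ n → P v ≡ true → Q v ≡ true) →
    countWords n P ≤ countWords n Q
  countWords-mono P⇒Q = countWords-injection (λ v → v) (λ (len , Pv) → len , P⇒Q len Pv) (λ _ _ eq → eq)

  countWords-cong : ∀ {n P Q} → (∀ v → length v ≡ n → P v ≡ Q v) → countWords n P ≡ countWords n Q
  countWords-cong P≗Q = ≤-antisym (countWords-mono (λ len Pv → trans (sym (P≗Q _ len)) Pv))
                                  (countWords-mono (λ len Qv → trans (P≗Q _ len) Qv))

  countWords-∨-≤ : ∀ n P Q → countWords n (λ v → P v ∨ Q v) ≤ countWords n P + countWords n Q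
  countWords-∨-≤ n P Q = ≤-trans (m≤m+n _ _) (≤-reflexive (countWords-∨-∧ n P Q))

  countWords-∨-disjoint : ∀ n P Q → (∀ v → length v ≡ n → P v ∧ Q v ≡ false) →
    countWords n (λ v → P v ∨ Q v) ≡ countWords n P + countWords n Q
  countWords-∨-disjoint n P Q disjoint = begin
    countWords n (λ v → P v ∨ Q v)
      ≡⟨ +-identityʳ _ ⟨
    countWords n (λ v → P v ∨ Q v) + 0
      ≡⟨ cong (countWords n (λ v → P v ∨ Q v) +_) (countWords-none disjoint) ⟨
    countWords n (λ v → P v ∨ Q v) + countWords n (λ v → P v ∧ Q v)
      ≡⟨ countWords-∨-∧ n P Q ⟩
    countWords n P + countWords n Q ∎
    where open ≡-Reasoning

  countWords-reverse : ∀ n P → countWords n P ≡ countWords n (P ∘ reverse)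
  countWords-reverse n P = ≤-antisym
    (countWords-injection reverse
      (λ {v} (len , Pv) → trans (length-reverse v) len , trans (cong P (reverse-involutive v)) Pv)
      (λ _ _ → reverse-injective))
    (countWords-injection reverse (λ {v} (len , Pv) → trans (length-reverse v) len , Pv)
      (λ _ _ → reverse-injective))

  countWords-init : ∀ n P → countWords (suc n) (P ∘ take n) ≡ σ * countWords n P
  countWords-init n P = begin
    countWords (suc n) (P ∘ take n)                ≡⟨ countWords-reverse (suc n) (P ∘ take n) ⟩
    countWords (suc n) (P ∘ take n ∘ reverse)      ≡⟨ countWords-cong take-reverse ⟩
    countWords (suc n) (P ∘ reverse ∘ drop 1)      ≡⟨ countWords-tail n (P ∘ reverse) ⟩
    σ * countWords n (P ∘ reverse)                 ≡⟨ cong (σ *_) (countWords-reverse n P) ⟨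
    σ * countWords n P                             ∎
    where
    open ≡-Reasoning
    take-reverse : ∀ v → length v ≡ suc n → P (take n (reverse v)) ≡ P (reverse (drop 1 v))
    take-reverse (x ∷ xs) refl = cong P (begin
      take (length xs) (reverse (x ∷ xs))            ≡⟨ cong (take (length xs)) (unfold-reverse x xs) ⟩
      take (length xs) (reverse xs ∷ʳ x)             ≡⟨ cong (λ l → take l (reverse xs ∷ʳ x)) (length-reverse xs) ⟨
      take (length (reverse xs)) (reverse xs ∷ʳ x)   ≡⟨ take-length-++ (reverse xs) [ x ] ⟩
      reverse xs                                     ∎)

-- Occurrences of a k-mer

⌊≟w⌋⇒≡ : ∀ {σ} {u v : Word σ} → ⌊ u ≟w v ⌋ ≡ true → u ≡ v
⌊≟w⌋⇒≡ {u = u} {v} eq with u ≟w v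
... | yes u≡v = u≡v

≡⇒⌊≟w⌋ : ∀ {σ} {u v : Word σ} → u ≡ v → ⌊ u ≟w v ⌋ ≡ true
≡⇒⌊≟w⌋ {u = u} {v} u≡v with u ≟w v
... | yes _   = refl
... | no u≢v  = contradiction u≡v u≢v

δ : ∀ {σ} → Word σ → Word σ → ℕ
δ u v = if ⌊ u ≟w v ⌋ then 1 else 0

δ-refl : ∀ {σ} (u : Word σ) → δ u u ≡ 1
δ-refl u with u ≟w u
... | yes _  = refl
... | no u≢u = ⊥-elim (u≢u refl)

δ-≢ : ∀ {σ} {u v : Word σ} → u ≢ v → δ u v ≡ 0
δ-≢ {u = u} {v} u≢v with u ≟w v
... | yes u≡v = ⊥-elim (u≢v u≡v)
... | no _    = refl

countEq-cons : ∀ {σ} (w u : Word σ) us → countEq w (u ∷ us) ≡ δ w u + countEq w us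
countEq-cons w u us with w ≟w u
... | yes _ = refl
... | no _  = refl

windows-cons : ∀ {σ} k (x : Fin σ) xs → k ≤ length (x ∷ xs) →
  windows k (x ∷ xs) ≡ take k (x ∷ xs) ∷ windows k xs
windows-cons zero    x xs k≤ = refl
windows-cons (suc k) x xs k≤ rewrite ≤⇒≤ᵇ≡true k≤ = refl

windows-short : ∀ {σ} k (v : Word σ) → length v < k → windows k v ≡ []
windows-short (suc k) []      _  = refl
windows-short (suc k) (x ∷ v) v< rewrite >⇒≤ᵇ≡false v< = refl

occ : ∀ {σ} → ℕ → Word σ → Word σ → ℕ
occ k w v = countEq w (windows k v)

module _ {σ : ℕ} (k : ℕ) (w : Word σ) where

  occ-cons : ∀ x xs → k ≤ length (x ∷ xs) → occ k w (x ∷ xs) ≡ δ w (take k (x ∷ xs)) + occ k w xs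
  occ-cons x xs k≤ = trans (cong (countEq w) (windows-cons k x xs k≤)) (countEq-cons w _ _)

  occ-short : ∀ v → length v < k → occ k w v ≡ 0
  occ-short v v< = cong (countEq w) (windows-short k v v<)

  occ-tail-≤ : ∀ x xs → occ k w xs ≤ occ k w (x ∷ xs)
  occ-tail-≤ x xs with k ≤? length (x ∷ xs)
  ... | yes k≤ = subst (occ k w xs ≤_) (sym (occ-cons x xs k≤)) (m≤n+m _ _)
  ... | no k≰  = subst (_≤ occ k w (x ∷ xs)) (sym (occ-short xs (≤-trans (n≤1+n _) (≰⇒> k≰)))) z≤n

occ-exact : ∀ {σ} k (w v : Word σ) → length v ≡ k → occ k w v ≡ δ w v
occ-exact k w [] refl = trans (countEq-cons w [] []) (+-identityʳ (δ w []))
occ-exact k w (x ∷ v) len = begin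
  occ k w (x ∷ v)                        ≡⟨ occ-cons k w x v (≤-reflexive (sym len)) ⟩
  δ w (take k (x ∷ v)) + occ k w v       ≡⟨ cong₂ _+_ (cong (δ w) (take-all k (x ∷ v) (≤-reflexive len)))
                                                      (occ-short k w v (≤-reflexive len)) ⟩
  δ w (x ∷ v) + 0                        ≡⟨ +-identityʳ _ ⟩
  δ w (x ∷ v)                            ∎
  where open ≡-Reasoning

occ-self : ∀ {σ} k (w : Word σ) → length w ≡ k → occ k w w ≡ 1
occ-self k w len = trans (occ-exact k w w len) (δ-refl w)

module _ {σ : ℕ} (k : ℕ) .{{_ : NonZero k}} (w : Word σ) where

  occ-++-≥ : ∀ xs ys → occ k w xs + occ k w ys ≤ occ k w (xs ++ ys)
  occ-++-≥ [] ys = ≤-reflexive (cong (_+ occ k w ys) (occ-short k w [] (>-nonZero⁻¹ k)))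
  occ-++-≥ (x ∷ xs) ys with k ≤? length (x ∷ xs)
  ... | yes k≤ = begin
    occ k w (x ∷ xs) + occ k w ys
      ≡⟨ cong (_+ occ k w ys) (occ-cons k w x xs k≤) ⟩
    δ w (take k (x ∷ xs)) + occ k w xs + occ k w ys
      ≡⟨ +-assoc (δ w (take k (x ∷ xs))) _ _ ⟩
    δ w (take k (x ∷ xs)) + (occ k w xs + occ k w ys)
      ≤⟨ +-monoʳ-≤ _ (occ-++-≥ xs ys) ⟩
    δ w (take k (x ∷ xs)) + occ k w (xs ++ ys)
      ≡⟨ cong (λ u → δ w u + _) (take-++-≤ k (x ∷ xs) ys k≤) ⟨
    δ w (take k (x ∷ xs ++ ys)) + occ k w (xs ++ ys)
      ≡⟨ occ-cons k w x (xs ++ ys) (≤-trans k≤ (length-++-≤ˡ (x ∷ xs))) ⟨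
    occ k w (x ∷ xs ++ ys) ∎
    where open ≤-Reasoning
  ... | no k≰ = begin
    occ k w (x ∷ xs) + occ k w ys    ≡⟨ cong (_+ occ k w ys) (occ-short k w (x ∷ xs) (≰⇒> k≰)) ⟩
    occ k w ys                       ≤⟨ m≤n+m _ _ ⟩
    occ k w xs + occ k w ys          ≤⟨ occ-++-≥ xs ys ⟩
    occ k w (xs ++ ys)               ≤⟨ occ-tail-≤ k w x (xs ++ ys) ⟩
    occ k w (x ∷ xs ++ ys)           ∎
    where open ≤-Reasoning

  occ-take-≤ : ∀ m v → occ k w (take m v) ≤ occ k w v
  occ-take-≤ m v = ≤-trans (m≤m+n _ _)
    (subst (λ u → occ k w (take m v) + occ k w (drop m v) ≤ occ k w u) (take++drop≡id m v)
      (occ-++-≥ (take m v) (drop m v)))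

  occ-∷ʳ : ∀ x c → k ≤ length (x ∷ʳ c) → occ k w (x ∷ʳ c) ≡ occ k w x + δ w (suffix k (x ∷ʳ c))
  occ-∷ʳ x c k≤ with k ≤? length x
  occ-∷ʳ x c k≤ | no k≰ = begin
    occ k w (x ∷ʳ c)                         ≡⟨ occ-exact k w (x ∷ʳ c) len ⟩
    δ w (x ∷ʳ c)                             ≡⟨ cong (δ w) (suffix-exact k (x ∷ʳ c) len) ⟨
    δ w (suffix k (x ∷ʳ c))                  ≡⟨ cong (_+ δ w (suffix k (x ∷ʳ c))) (occ-short k w x (≰⇒> k≰)) ⟨
    occ k w x + δ w (suffix k (x ∷ʳ c))      ∎
    where
    open ≡-Reasoning
    len : length (x ∷ʳ c) ≡ k
    len = ≤-antisym (subst (_≤ k) (sym (length-∷ʳ x c)) (≰⇒> k≰)) k≤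
  occ-∷ʳ [] c k≤ | yes k≤0 = contradiction k≤0 (<⇒≱ (>-nonZero⁻¹ k))
  occ-∷ʳ (a ∷ x) c _ | yes k≤ = begin
    occ k w (a ∷ v)
      ≡⟨ occ-cons k w a v k≤v′ ⟩
    δ w (take k (a ∷ v)) + occ k w v
      ≡⟨ cong₂ _+_ (cong (δ w) (take-++-≤ k (a ∷ x) [ c ] k≤))
                                                                           (occ-∷ʳ x c k≤v) ⟩
    δ w (take k (a ∷ x)) + (occ k w x + δ w (suffix k v))
      ≡⟨ +-assoc (δ w (take k (a ∷ x))) _ _ ⟨
    δ w (take k (a ∷ x)) + occ k w x + δ w (suffix k v)
      ≡⟨ cong₂ _+_ (occ-cons k w a x k≤) (cong (δ w) (suffix-cons k a v k≤v)) ⟨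
    occ k w (a ∷ x) + δ w (suffix k (a ∷ v)) ∎
    where
    open ≡-Reasoning
    v = x ∷ʳ c
    k≤v : k ≤ length v
    k≤v = subst (k ≤_) (sym (length-∷ʳ x c)) k≤
    k≤v′ : k ≤ length (a ∷ v)
    k≤v′ = ≤-trans k≤v (n≤1+n _)

  -- The windows of x ++ y starting in x and ending in y are those starting at a suffix s of x.
  NoStraddle : Word σ → Word σ → Set
  NoStraddle x y = ∀ s {t} → t ++ s ≡ x → 0 < length s → length s < k → k ≤ length (s ++ y) →
    w ≢ take k (s ++ y)

  occ-++-no-straddle : ∀ x y → occ k w x ≡ 0 → NoStraddle x y → occ k w (x ++ y) ≡ occ k w y
  occ-++-no-straddle [] y _ _ = refl
  occ-++-no-straddle (a ∷ x) y x-avoids no-straddle with k ≤? length (a ∷ x ++ y)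
  ... | no k≰ = trans (occ-short k w (a ∷ x ++ y) (≰⇒> k≰))
                      (sym (occ-short k w y (≤-trans (s≤s (length-++-≤ʳ y {a ∷ x})) (≰⇒> k≰))))
  ... | yes k≤ = begin
    occ k w (a ∷ x ++ y)
      ≡⟨ occ-cons k w a (x ++ y) k≤ ⟩
    δ w (take k (a ∷ x ++ y)) + occ k w (x ++ y)
      ≡⟨ cong₂ _+_ first-window (occ-++-no-straddle x y x-avoids′ (λ s eq → no-straddle s (cong (a ∷_) eq))) ⟩
    0 + occ k w y ∎
    where
    open ≡-Reasoning
    x-avoids′ : occ k w x ≡ 0
    x-avoids′ = n≤0⇒n≡0 (subst (occ k w x ≤_) x-avoids (occ-tail-≤ k w a x))
    first-window : δ w (take k (a ∷ x ++ y)) ≡ 0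
    first-window with k ≤? length (a ∷ x)
    ... | yes k≤ax = trans (cong (δ w) (take-++-≤ k (a ∷ x) y k≤ax))
                           (m+n≡0⇒m≡0 _ (trans (sym (occ-cons k w a x k≤ax)) x-avoids))
    ... | no k≰ax = δ-≢ (no-straddle (a ∷ x) {[]} refl (s≤s z≤n) (≰⇒> k≰ax) k≤)

module _ {σ : ℕ} (k : ℕ) (w : Word σ) where

  avoids : Word σ → Bool
  avoids v = occ k w v ≡ᵇ 0

  -- soleAtEnd k (toList r) is Defs.inS r, so #soleAtEnd k (toList r) n is CS r n.
  soleAtEnd : Word σ → Bool
  soleAtEnd v = (k ≤ᵇ length v) ∧ (⌊ suffix k v ≟w w ⌋ ∧ (occ k w v ≡ᵇ 1))

  startsWith : Word σ → Bool
  startsWith v = ⌊ w ≟w take k v ⌋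

  #avoiding : ℕ → ℕ
  #avoiding n = countWords n avoids

  #soleAtEnd : ℕ → ℕ
  #soleAtEnd n = countWords n soleAtEnd

  avoids⁻ : ∀ {v} → avoids v ≡ true → occ k w v ≡ 0
  avoids⁻ {v} h = ≡ᵇ⇒≡ (occ k w v) 0 (≡true⇒T h)

  avoids⁺ : ∀ {v} → occ k w v ≡ 0 → avoids v ≡ true
  avoids⁺ {v} h = T⇒≡true (≡⇒≡ᵇ (occ k w v) 0 h)

  soleAtEnd⁻ : ∀ {v} → soleAtEnd v ≡ true → k ≤ length v × suffix k v ≡ w × occ k w v ≡ 1
  soleAtEnd⁻ {v} with k ≤ᵇ length v in k≤ | suffix k v ≟w w | occ k w v ≡ᵇ 1 in once
  ... | true  | yes s≡w | true  = λ _ → ≤ᵇ⇒≤ k _ (≡true⇒T k≤) , s≡w , ≡ᵇ⇒≡ _ 1 (≡true⇒T once)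
  ... | true  | yes _   | false = λ ()
  ... | true  | no _    | _     = λ ()
  ... | false | _       | _     = λ ()

  soleAtEnd⁺ : ∀ {v} → k ≤ length v → suffix k v ≡ w → occ k w v ≡ 1 → soleAtEnd v ≡ true
  soleAtEnd⁺ {v} k≤ s≡w once rewrite ≤⇒≤ᵇ≡true k≤ | s≡w | once with w ≟w w
  ... | yes _  = refl
  ... | no w≢w = ⊥-elim (w≢w refl)

  soleAtEnd-split : ∀ {v} m → soleAtEnd v ≡ true → length v ≡ m + k → v ≡ take m v ++ w
  soleAtEnd-split {v} m sole len = begin
    v                                     ≡⟨ take++drop≡id (length v ∸ k) v ⟨
    take (length v ∸ k) v ++ suffix k v   ≡⟨ cong₂ (λ i u → take i v ++ u) |v|∸k≡m (proj₁ (proj₂ (soleAtEnd⁻ sole))) ⟩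
    take m v ++ w                         ∎
    where
    open ≡-Reasoning
    |v|∸k≡m : length v ∸ k ≡ m
    |v|∸k≡m = trans (cong (_∸ k) len) (m+n∸n≡m m k)

  avoids∧soleAtEnd : ∀ v → avoids v ∧ soleAtEnd v ≡ false
  avoids∧soleAtEnd v with occ k w v
  ... | zero  = trans (cong ((k ≤ᵇ length v) ∧_) (∧-zeroʳ _)) (∧-zeroʳ _)
  ... | suc _ = refl

  #soleAtEnd-short : ∀ n → n < k → #soleAtEnd n ≡ 0
  #soleAtEnd-short n n<k = countWords-none λ v len →
    cong (_∧ (⌊ suffix k v ≟w w ⌋ ∧ (occ k w v ≡ᵇ 1))) (>⇒≤ᵇ≡false (subst (_< k) (sym len) n<k))

  #avoiding-short : ∀ n → n < k → #avoiding n ≡ σ ^ n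
  #avoiding-short n n<k =
    trans (countWords-cong λ v len → cong (_≡ᵇ 0) (occ-short k w v (subst (_< k) (sym len) n<k))) (countWords-all n)

module _ {σ : ℕ} (k : ℕ) .{{_ : NonZero k}} (w : Word σ) where

  avoids-∷ʳ : ∀ x c → avoids k w x ≡ avoids k w (x ∷ʳ c) ∨ soleAtEnd k w (x ∷ʳ c)
  avoids-∷ʳ x c with k ≤? length (x ∷ʳ c)
  ... | no k≰ rewrite occ-short k w x (<-trans (n<1+n _) (subst (_< k) (length-∷ʳ x c) (≰⇒> k≰)))
                    | occ-short k w (x ∷ʳ c) (≰⇒> k≰) = refl
  ... | yes k≤ rewrite occ-∷ʳ k w x c k≤ | ≤⇒≤ᵇ≡true k≤ with suffix k (x ∷ʳ c) ≟w w
  ...   | yes s≡w rewrite s≡w | δ-refl w | +-comm (occ k w x) 1 = refl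
  ...   | no s≢w  rewrite δ-≢ (s≢w ∘ sym) | +-identityʳ (occ k w x) = sym (∨-identityʳ _)

  #avoiding-suc : ∀ n → #avoiding k w (suc n) + #soleAtEnd k w (suc n) ≡ σ * #avoiding k w n
  #avoiding-suc n = begin
    #avoiding k w (suc n) + #soleAtEnd k w (suc n)
      ≡⟨ countWords-∨-disjoint (suc n) _ _ (λ v _ → avoids∧soleAtEnd k w v) ⟨
    countWords (suc n) (λ v → avoids k w v ∨ soleAtEnd k w v)
      ≡⟨ countWords-cong init-avoids ⟩
    countWords (suc n) (avoids k w ∘ take n)
      ≡⟨ countWords-init n (avoids k w) ⟩
    σ * #avoiding k w n ∎
    where
    open ≡-Reasoning
    init-avoids : ∀ v → length v ≡ suc n → avoids k w v ∨ soleAtEnd k w v ≡ avoids k w (take n v)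
    init-avoids v len with initLast v
    ... | u ∷ʳ′ c = trans (sym (avoids-∷ʳ u c)) (cong (avoids k w) (sym (begin
      take n (u ∷ʳ c)             ≡⟨ cong (λ i → take i (u ∷ʳ c)) n≡|u| ⟩
      take (length u) (u ∷ʳ c)    ≡⟨ take-length-++ u [ c ] ⟩
      u                           ∎)))
      where
      n≡|u| : n ≡ length u
      n≡|u| = suc-injective (trans (sym len) (length-∷ʳ u c))

  #avoiding-suc-≤ : ∀ n → #avoiding k w (suc n) ≤ σ * #avoiding k w n
  #avoiding-suc-≤ n = subst (#avoiding k w (suc n) ≤_) (#avoiding-suc n) (m≤m+n _ _)

  #avoiding-+-≤ : ∀ m j → #avoiding k w (m + j) ≤ σ ^ j * #avoiding k w m
  #avoiding-+-≤ m zero    = ≤-reflexive (trans (cong (#avoiding k w) (+-identityʳ m)) (sym (*-identityˡ _)))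
  #avoiding-+-≤ m (suc j) = begin
    #avoiding k w (m + suc j)             ≡⟨ cong (#avoiding k w) (+-suc m j) ⟩
    #avoiding k w (suc (m + j))           ≤⟨ #avoiding-suc-≤ (m + j) ⟩
    σ * #avoiding k w (m + j)             ≤⟨ *-monoʳ-≤ σ (#avoiding-+-≤ m j) ⟩
    σ * (σ ^ j * #avoiding k w m)         ≡⟨ *-assoc σ (σ ^ j) _ ⟨
    σ ^ suc j * #avoiding k w m           ∎
    where open ≤-Reasoning

  soleAtEnd-prefix-avoids : ∀ {v} m → soleAtEnd k w v ≡ true → m < length v → occ k w (take m v) ≡ 0
  soleAtEnd-prefix-avoids {v} m sole m<v with initLast v | soleAtEnd⁻ k w sole
  ... | [] | _ = contradiction m<v λ ()
  ... | u ∷ʳ′ c | k≤ , s≡w , once = n≤0⇒n≡0 (begin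
    occ k w (take m (u ∷ʳ c))   ≡⟨ cong (occ k w) (take-++-≤ m u [ c ] m≤u) ⟩
    occ k w (take m u)          ≤⟨ occ-take-≤ k w m u ⟩
    occ k w u                   ≡⟨ +-cancelʳ-≡ 1 _ 0 u-then-c ⟩
    0                           ∎)
    where
    open ≤-Reasoning
    u-then-c : occ k w u + 1 ≡ 1
    u-then-c = begin-equality
      occ k w u + 1                          ≡⟨ cong (occ k w u +_) (trans (cong (δ w) s≡w) (δ-refl w)) ⟨
      occ k w u + δ w (suffix k (u ∷ʳ c))    ≡⟨ occ-∷ʳ k w u c k≤ ⟨
      occ k w (u ∷ʳ c)                       ≡⟨ once ⟩
      1                                      ∎
    m≤u : m ≤ length u
    m≤u = ≤-pred (subst (m <_) (length-∷ʳ u c) m<v)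

  soleAtEnd-prefix : ∀ {n v} m → m < n → IsWord n (soleAtEnd k w) v → IsWord m (avoids k w) (take m v)
  soleAtEnd-prefix {n} {v} m m<n (len , sole) =
    length-take-≤ m v (<⇒≤ (subst (m <_) (sym len) m<n)) ,
    avoids⁺ k w (soleAtEnd-prefix-avoids m sole (subst (m <_) (sym len) m<n))

  soleAtEnd-prefix-injective : ∀ {u v} m → IsWord (m + k) (soleAtEnd k w) u → IsWord (m + k) (soleAtEnd k w) v →
    take m u ≡ take m v → u ≡ v
  soleAtEnd-prefix-injective {u} {v} m (len-u , sole-u) (len-v , sole-v) eq = begin
    u                  ≡⟨ soleAtEnd-split k w m sole-u len-u ⟩
    take m u ++ w      ≡⟨ cong (_++ w) eq ⟩
    take m v ++ w      ≡⟨ soleAtEnd-split k w m sole-v len-v ⟨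
    v                  ∎
    where open ≡-Reasoning

  #soleAtEnd≤#avoiding : ∀ n → #soleAtEnd k w (n + k) ≤ #avoiding k w n
  #soleAtEnd≤#avoiding n = countWords-injection (take n)
    (soleAtEnd-prefix n (m<m+n n (>-nonZero⁻¹ k))) (soleAtEnd-prefix-injective n)

-- Periods and self-overlaps

overlap⇒IsPeriod : ∀ {σ} (s w : Word σ) → 0 < length s → length s < length w →
  w ≡ take (length w) (s ++ w) → IsPeriod w (length s)
overlap⇒IsPeriod s w s>0 s<w self-overlap = s>0 , s<w , (begin
  take (length w ∸ length s) w                         ≡⟨ drop-length-++ s _ ⟨
  drop (length s) (s ++ take (length w ∸ length s) w)  ≡⟨ cong (drop (length s)) (take-++-≥ (length w) s w (<⇒≤ s<w)) ⟨
  drop (length s) (take (length w) (s ++ w))           ≡⟨ cong (drop (length s)) self-overlap ⟨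
  drop (length s) w                                    ∎)
  where open ≡-Reasoning

IsPeriod⇒overlap : ∀ {σ} (w : Word σ) q → IsPeriod w q → w ≡ take (length w) (take q w ++ w)
IsPeriod⇒overlap w q (_ , q<w , period) = sym (begin
  take (length w) (take q w ++ w)
    ≡⟨ take-++-≥ (length w) (take q w) w (≤-trans (≤-reflexive |take-q|) (<⇒≤ q<w)) ⟩
  take q w ++ take (length w ∸ length (take q w)) w ≡⟨ cong (λ i → take q w ++ take (length w ∸ i) w) |take-q| ⟩
  take q w ++ take (length w ∸ q) w
    ≡⟨ cong (take q w ++_) period ⟩
  take q w ++ drop q w
    ≡⟨ take++drop≡id q w ⟩
  w ∎)
  where
  open ≡-Reasoning
  |take-q| : length (take q w) ≡ q
  |take-q| = length-take-≤ q w (<⇒≤ q<w)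

module _ {σ : ℕ} (k : ℕ) .{{_ : NonZero k}} (w : Word σ) (|w|≡k : length w ≡ k) where

  soleAtEnd-++ : ∀ x → occ k w (x ++ w) ≡ 1 → soleAtEnd k w (x ++ w) ≡ true
  soleAtEnd-++ x once = soleAtEnd⁺ k w
    (subst (λ i → i ≤ length (x ++ w)) |w|≡k (length-++-≤ʳ w {x}))
    (subst (λ i → suffix i (x ++ w) ≡ w) |w|≡k (suffix-++ x w)) once

  #avoiding≤#soleAtEnd-aperiodic : ¬ Σ ℕ (IsPeriod w) → ∀ n → #avoiding k w n ≤ #soleAtEnd k w (n + k)
  #avoiding≤#soleAtEnd-aperiodic aperiodic n = countWords-injection (_++ w)
    (λ {x} (len , avoids-x) → trans (length-++ x) (cong₂ _+_ len |w|≡k) ,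
      soleAtEnd-++ x (trans (occ-++-no-straddle k w x w (avoids⁻ k w avoids-x) no-straddle) (occ-self k w |w|≡k)))
    (λ {u} {v} _ _ → ++-cancelʳ w u v)
    where
    no-straddle : ∀ {x} → NoStraddle k w x w
    no-straddle s _ s>0 s<k _ w-overlap = aperiodic (length s ,
      overlap⇒IsPeriod s w s>0 (subst (length s <_) (sym |w|≡k) s<k)
        (subst (λ i → w ≡ take i (s ++ w)) (sym |w|≡k) w-overlap))

  #soleAtEnd-aperiodic : ¬ Σ ℕ (IsPeriod w) → ∀ n → #soleAtEnd k w (n + k) ≡ #avoiding k w n
  #soleAtEnd-aperiodic aperiodic n = ≤-antisym (#soleAtEnd≤#avoiding k w n) (#avoiding≤#soleAtEnd-aperiodic aperiodic n)

  -- If u and v agree on their first n + q letters, then u = z · w[0..q) · w with z · w = v,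
  -- and the period q makes z · w a proper prefix of u: a second occurrence of w in u.
  periodic-prefixes-differ : ∀ q → IsPeriod w q → ∀ n {u v} →
    IsWord (n + q + k) (soleAtEnd k w) u → IsWord (n + k) (soleAtEnd k w) v → take (n + q) u ≢ take (n + q) v
  periodic-prefixes-differ q period@(q>0 , _ , _) n {u} {v} long@(len-u , sole-u) (len-v , sole-v) eq =
    contradiction (subst (1 ≤_) prefix-avoids prefix-has-w) λ ()
    where
    z = take n v
    |z|≡n : length z ≡ n
    |z|≡n = length-take-≤ n v (subst (n ≤_) (sym len-v) (m≤m+n n k))
    u≡zww : u ≡ z ++ (take q w ++ w)
    u≡zww = begin
      u                                   ≡⟨ soleAtEnd-split k w (n + q) sole-u len-u ⟩
      take (n + q) u ++ w                 ≡⟨ cong (_++ w) eq ⟩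
      take (n + q) v ++ w                 ≡⟨ cong (λ y → take (n + q) y ++ w) (soleAtEnd-split k w n sole-v len-v) ⟩
      take (n + q) (z ++ w) ++ w          ≡⟨ cong (λ i → take (i + q) (z ++ w) ++ w) |z|≡n ⟨
      take (length z + q) (z ++ w) ++ w   ≡⟨ cong (_++ w) (take-length-++-+ z w q) ⟩
      (z ++ take q w) ++ w                ≡⟨ ++-assoc z (take q w) w ⟩
      z ++ (take q w ++ w)                ∎
      where open ≡-Reasoning
    prefix-is-zw : take (n + k) u ≡ z ++ w
    prefix-is-zw = begin
      take (n + k) u                                   ≡⟨ cong (take (n + k)) u≡zww ⟩
      take (n + k) (z ++ (take q w ++ w))              ≡⟨ cong (λ i → take (i + k) (z ++ (take q w ++ w))) |z|≡n ⟨
      take (length z + k) (z ++ (take q w ++ w))       ≡⟨ take-length-++-+ z _ k ⟩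
      z ++ take k (take q w ++ w)                      ≡⟨ cong (λ i → z ++ take i (take q w ++ w)) |w|≡k ⟨
      z ++ take (length w) (take q w ++ w)             ≡⟨ cong (z ++_) (IsPeriod⇒overlap w q period) ⟨
      z ++ w                                           ∎
      where open ≡-Reasoning
    prefix-avoids : occ k w (take (n + k) u) ≡ 0
    prefix-avoids = avoids⁻ k w (proj₂ (soleAtEnd-prefix k w (n + k) (+-monoˡ-< k (m<m+n n q>0)) long))
    prefix-has-w : 1 ≤ occ k w (take (n + k) u)
    prefix-has-w = begin
      1                           ≡⟨ occ-self k w |w|≡k ⟨
      occ k w w                   ≤⟨ m≤n+m _ _ ⟩
      occ k w z + occ k w w       ≤⟨ occ-++-≥ k w z w ⟩
      occ k w (z ++ w)            ≡⟨ cong (occ k w) prefix-is-zw ⟨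
      occ k w (take (n + k) u)    ∎
      where open ≤-Reasoning

  #soleAtEnd-periodic : ∀ q → IsPeriod w q → ∀ n →
    #soleAtEnd k w (n + q + k) + #soleAtEnd k w (n + k) ≤ #avoiding k w (n + q)
  #soleAtEnd-periodic q period@(q>0 , q<w , _) n =
    countWords-injection₂ (take (n + q)) (λ eq → <⇒≢ (+-monoˡ-< k (m<m+n n q>0)) (sym eq))
      (soleAtEnd-prefix k w (n + q) (m<m+n (n + q) (>-nonZero⁻¹ k)))
      (soleAtEnd-prefix k w (n + q) (+-monoʳ-< n (subst (q <_) |w|≡k q<w)))
      injective
    where
    injective : ∀ {u v} → IsWord (n + q + k) (soleAtEnd k w) u ⊎ IsWord (n + k) (soleAtEnd k w) u →
                          IsWord (n + q + k) (soleAtEnd k w) v ⊎ IsWord (n + k) (soleAtEnd k w) v →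
                          take (n + q) u ≡ take (n + q) v → u ≡ v
    injective (inj₁ long-u)  (inj₁ long-v)  eq = soleAtEnd-prefix-injective k w (n + q) long-u long-v eq
    injective (inj₁ long-u)  (inj₂ short-v) eq = contradiction eq (periodic-prefixes-differ q period n long-u short-v)
    injective (inj₂ short-u) (inj₁ long-v)  eq = contradiction (sym eq) (periodic-prefixes-differ q period n long-v short-u)
    injective {u} {v} (inj₂ short-u) (inj₂ short-v) eq = soleAtEnd-prefix-injective k w n short-u short-v (begin
      take n u                   ≡⟨ take-prefix u ⟨
      take n (take (n + q) u)    ≡⟨ cong (take n) eq ⟩
      take n (take (n + q) v)    ≡⟨ take-prefix v ⟩
      take n v                   ∎)
      where
      open ≡-Reasoning
      take-prefix : ∀ y → take n (take (n + q) y) ≡ take n y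
      take-prefix y = trans (take-take n (n + q) y) (cong (λ i → take i y) (m≤n⇒m⊓n≡m (m≤m+n n q)))

-- Appending a letter that does not end the k-mer

module _ {σ : ℕ} (k : ℕ) .{{_ : NonZero k}} (w : Word σ) (c : Fin σ) (c-not-last : ∀ u → w ≢ u ∷ʳ c) where

  occ-∷ʳ-not-last : ∀ x → occ k w (x ∷ʳ c) ≡ occ k w x
  occ-∷ʳ-not-last x with k ≤? length (x ∷ʳ c)
  ... | no k≰ = trans (occ-short k w (x ∷ʳ c) (≰⇒> k≰))
                      (sym (occ-short k w x (<-trans (n<1+n _) (subst (_< k) (length-∷ʳ x c) (≰⇒> k≰)))))
  ... | yes k≤ = begin
    occ k w (x ∷ʳ c)
      ≡⟨ occ-∷ʳ k w x c k≤ ⟩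
    occ k w x + δ w (suffix k (x ∷ʳ c))
      ≡⟨ cong (occ k w x +_) (δ-≢ (λ eq → c-not-last (drop i x) (trans eq (drop-++-≤ i x [ c ] i≤x)))) ⟩
    occ k w x + 0
      ≡⟨ +-identityʳ _ ⟩
    occ k w x ∎
    where
    open ≡-Reasoning
    i = length (x ∷ʳ c) ∸ k
    i≤x : i ≤ length x
    i≤x = subst (_≤ length x) (cong (_∸ k) (sym (length-∷ʳ x c))) (∸-monoʳ-≤ (suc (length x)) (>-nonZero⁻¹ k))

  occ-++-replicate : ∀ x j → occ k w (x ++ replicate j c) ≡ occ k w x
  occ-++-replicate x zero    = cong (occ k w) (++-identityʳ x)
  occ-++-replicate x (suc j) = begin
    occ k w (x ++ c ∷ replicate j c)      ≡⟨ cong (occ k w) (++-assoc x [ c ] (replicate j c)) ⟨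
    occ k w ((x ∷ʳ c) ++ replicate j c)   ≡⟨ occ-++-replicate (x ∷ʳ c) j ⟩
    occ k w (x ∷ʳ c)                      ≡⟨ occ-∷ʳ-not-last x ⟩
    occ k w x                             ∎
    where open ≡-Reasoning

  #avoiding-mono : ∀ n → #avoiding k w n ≤ #avoiding k w (suc n)
  #avoiding-mono n = countWords-injection (_∷ʳ c)
    (λ {x} (len , avoids-x) → trans (length-∷ʳ x c) (cong suc len) ,
                             avoids⁺ k w (trans (occ-∷ʳ-not-last x) (avoids⁻ k w avoids-x)))
    (λ {u} {v} _ _ → ∷ʳ-injectiveˡ u v)

  #avoiding-pos : ∀ n → 1 ≤ #avoiding k w n
  #avoiding-pos zero    = ≤-reflexive (sym (#avoiding-short k w 0 (>-nonZero⁻¹ k)))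
  #avoiding-pos (suc n) = ≤-trans (#avoiding-pos n) (#avoiding-mono n)

  #avoiding-monotone : ∀ {m n} → m ≤ n → #avoiding k w m ≤ #avoiding k w n
  #avoiding-monotone {m} {n} m≤n = subst (λ i → #avoiding k w m ≤ #avoiding k w i) (m+[n∸m]≡n m≤n) (go (n ∸ m))
    where
    go : ∀ j → #avoiding k w m ≤ #avoiding k w (m + j)
    go zero    = ≤-reflexive (cong (#avoiding k w) (sym (+-identityʳ m)))
    go (suc j) = ≤-trans (go j)
      (subst (λ i → #avoiding k w (m + j) ≤ #avoiding k w i) (sym (+-suc m j)) (#avoiding-mono (m + j)))

  -- x ↦ x cᵏ w.  The string x cᵏ still avoids w, and an occurrence of w straddling cᵏ and the final
  -- w would be a self-overlap of w shifted by a block of c's, forcing every letter of w to be c.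
  #avoiding≤#soleAtEnd-padded : length w ≡ k → ∀ n → #avoiding k w n ≤ #soleAtEnd k w (n + k + k)
  #avoiding≤#soleAtEnd-padded |w|≡k n = countWords-injection pad
    (λ {x} (len , avoids-x) → |pad| x len ,
      soleAtEnd-++ k w |w|≡k (x ++ c^k) (begin
        occ k w ((x ++ c^k) ++ w)   ≡⟨ occ-++-no-straddle k w (x ++ c^k) w
                                         (trans (occ-++-replicate x k) (avoids⁻ k w avoids-x)) no-straddle ⟩
        occ k w w                   ≡⟨ occ-self k w |w|≡k ⟩
        1                           ∎))
    (λ {u} {v} _ _ eq → ++-cancelʳ c^k u v (++-cancelʳ w (u ++ c^k) (v ++ c^k) eq))
    where
    open ≡-Reasoning
    c^k = replicate k c
    pad : Word σ → Word σ
    pad x = (x ++ c^k) ++ w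
    |pad| : ∀ x → length x ≡ n → length (pad x) ≡ n + k + k
    |pad| x len = begin
      length ((x ++ c^k) ++ w)            ≡⟨ length-++ (x ++ c^k) ⟩
      length (x ++ c^k) + length w        ≡⟨ cong (_+ length w) (length-++ x) ⟩
      length x + length c^k + length w    ≡⟨ cong₂ (λ a b → a + b + length w) len (length-replicate k) ⟩
      n + k + length w                    ≡⟨ cong (n + k +_) |w|≡k ⟩
      n + k + k                           ∎
    no-straddle : ∀ {x} → NoStraddle k w (x ++ c^k) w
    no-straddle {x} s {t} eq s>0 s<k _ w-overlap =
      let t′ , t′s≡c^k = suffix-of-++ x c^k t s eq (subst (length s ≤_) (sym (length-replicate k)) (<⇒≤ s<k))
          s-all-c = All.++⁻ʳ t′ (subst (All (_≡ c)) (sym t′s≡c^k) (All.replicate⁺ k refl))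
          all-c = All-self-overlap s w s>0 s-all-c (subst (λ i → w ≡ take i (s ++ w)) (sym |w|≡k) w-overlap)
          u , w≡uc = All-≡-∷ʳ w (subst (0 <_) (sym |w|≡k) (>-nonZero⁻¹ k)) all-c
      in c-not-last u w≡uc

-- All aperiodic k-mers have the same counts

module _ {σ : ℕ} (k : ℕ) .{{_ : NonZero k}} (u v : Word σ) (|u|≡k : length u ≡ k) (|v|≡k : length v ≡ k)
         (u-aperiodic : ¬ Σ ℕ (IsPeriod u)) (v-aperiodic : ¬ Σ ℕ (IsPeriod v)) where

  private
    #soleAtEnd-agree-below : ∀ n → (∀ {j} → j < n → #avoiding k u j ≡ #avoiding k v j) →
      #soleAtEnd k u n ≡ #soleAtEnd k v n
    #soleAtEnd-agree-below n agree with n <? k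
    ... | yes n<k = trans (#soleAtEnd-short k u n n<k) (sym (#soleAtEnd-short k v n n<k))
    ... | no n≮k  = begin
      #soleAtEnd k u n         ≡⟨ cong (#soleAtEnd k u) j+k≡n ⟨
      #soleAtEnd k u (j + k)   ≡⟨ #soleAtEnd-aperiodic k u |u|≡k u-aperiodic j ⟩
      #avoiding k u j          ≡⟨ agree (subst (j <_) j+k≡n (m<m+n j (>-nonZero⁻¹ k))) ⟩
      #avoiding k v j          ≡⟨ #soleAtEnd-aperiodic k v |v|≡k v-aperiodic j ⟨
      #soleAtEnd k v (j + k)   ≡⟨ cong (#soleAtEnd k v) j+k≡n ⟩
      #soleAtEnd k v n         ∎
      where
      open ≡-Reasoning
      j = n ∸ k
      j+k≡n : j + k ≡ n
      j+k≡n = m∸n+n≡m (≮⇒≥ n≮k)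

    #avoiding-by-recurrence : ∀ (w : Word σ) n →
      #avoiding k w (suc n) ≡ σ * #avoiding k w n ∸ #soleAtEnd k w (suc n)
    #avoiding-by-recurrence w n =
      trans (sym (m+n∸n≡m _ (#soleAtEnd k w (suc n)))) (cong (_∸ #soleAtEnd k w (suc n)) (#avoiding-suc k w n))

  aperiodic-#avoiding-agree : ∀ n → #avoiding k u n ≡ #avoiding k v n
  aperiodic-#avoiding-agree = <-rec _ step
    where
    step : ∀ n → (∀ {j} → j < n → #avoiding k u j ≡ #avoiding k v j) → #avoiding k u n ≡ #avoiding k v n
    step zero    _     = trans (#avoiding-short k u 0 (>-nonZero⁻¹ k)) (sym (#avoiding-short k v 0 (>-nonZero⁻¹ k)))
    step (suc n) agree = begin
      #avoiding k u (suc n)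
        ≡⟨ #avoiding-by-recurrence u n ⟩
      σ * #avoiding k u n ∸ #soleAtEnd k u (suc n)
        ≡⟨ cong₂ (λ a s → σ * a ∸ s) (agree (n<1+n n)) (#soleAtEnd-agree-below (suc n) agree) ⟩
      σ * #avoiding k v n ∸ #soleAtEnd k v (suc n)
        ≡⟨ #avoiding-by-recurrence v n ⟨
      #avoiding k v (suc n) ∎
      where open ≡-Reasoning

  aperiodic-#soleAtEnd-agree : ∀ n → #soleAtEnd k u n ≡ #soleAtEnd k v n
  aperiodic-#soleAtEnd-agree n = #soleAtEnd-agree-below n (λ {j} _ → aperiodic-#avoiding-agree j)

-- Comparing growth rates

-- Read X, Y, X′, Y′, X₀, Y₀ as b n, a n, b (n+1), a (n+1), b m, a m with n = m + d: if b/a has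
-- not decreased from m to n, it grows by the factor (M+1)/M from n to n+1, where M = (Q+1)T.
ratio-step : ∀ σ Q T X Y X′ Y′ X₀ Y₀ →
  suc Q * (σ * X) ≤ suc Q * X′ + Q * X₀ → Y′ + Y₀ ≤ σ * Y → Y′ ≤ T * Y₀ → X₀ * Y ≤ X * Y₀ →
  suc (suc Q * T) * X * Y′ ≤ suc Q * T * X′ * Y
ratio-step σ Q T X Y X′ Y′ X₀ Y₀ X-step Y-step Y′≤ ratio₀ = begin
  suc (suc Q * T) * X * Y′
    ≡⟨ expand Q T X Y′ ⟩
  T * (suc Q * X * Y′) + X * Y′
    ≤⟨ +-monoʳ-≤ (T * (suc Q * X * Y′)) (≤-trans (*-monoʳ-≤ X Y′≤) (≤-reflexive (swap X T Y₀))) ⟩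
  T * (suc Q * X * Y′) + T * (X * Y₀)
    ≡⟨ *-distribˡ-+ T _ _ ⟨
  T * (suc Q * X * Y′ + X * Y₀)
    ≤⟨ *-monoʳ-≤ T (+-cancelʳ-≤ (Q * (X * Y₀)) _ _ cross) ⟩
  T * (suc Q * X′ * Y)
    ≡⟨ pull T Q X′ Y ⟩
  suc Q * T * X′ * Y ∎
  where
  open ≤-Reasoning
  expand : ∀ Q T X Y′ → suc (suc Q * T) * X * Y′ ≡ T * (suc Q * X * Y′) + X * Y′
  expand = solve-∀
  swap : ∀ a b c → a * (b * c) ≡ b * (a * c)
  swap = solve-∀
  pull : ∀ T Q X′ Y → T * (suc Q * X′ * Y) ≡ suc Q * T * X′ * Y
  pull = solve-∀
  collect : ∀ Q X Y′ Y₀ → suc Q * X * Y′ + X * Y₀ + Q * (X * Y₀) ≡ suc Q * X * (Y′ + Y₀)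
  collect = solve-∀
  distrib : ∀ Q X′ X₀ Y → (suc Q * X′ + Q * X₀) * Y ≡ suc Q * X′ * Y + Q * (X₀ * Y)
  distrib = solve-∀
  commute : ∀ Q X σ Y → suc Q * X * (σ * Y) ≡ suc Q * (σ * X) * Y
  commute = solve-∀
  cross : suc Q * X * Y′ + X * Y₀ + Q * (X * Y₀) ≤ suc Q * X′ * Y + Q * (X * Y₀)
  cross = begin
    suc Q * X * Y′ + X * Y₀ + Q * (X * Y₀)   ≡⟨ collect Q X Y′ Y₀ ⟩
    suc Q * X * (Y′ + Y₀)                    ≤⟨ *-monoʳ-≤ (suc Q * X) Y-step ⟩
    suc Q * X * (σ * Y)                      ≡⟨ commute Q X σ Y ⟩
    suc Q * (σ * X) * Y                      ≤⟨ *-monoˡ-≤ Y X-step ⟩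
    (suc Q * X′ + Q * X₀) * Y                ≡⟨ distrib Q X′ X₀ Y ⟩
    suc Q * X′ * Y + Q * (X₀ * Y)            ≤⟨ +-monoʳ-≤ (suc Q * X′ * Y) (*-monoʳ-≤ Q ratio₀) ⟩
    suc Q * X′ * Y + Q * (X * Y₀)            ∎

-- a and b obey the same recurrence with a delay of d steps, except that the delayed term damps b
-- only with weight Q/(Q+1).  Then b/a never decreases, and grows at least linearly after step d.
module Domination (σ d Q T : ℕ) (a b : ℕ → ℕ)
  (a-pos : ∀ n → 1 ≤ a n)
  (a-delay : ∀ m → a (suc (m + d)) + a m ≤ σ * a (m + d))
  (a-growth : ∀ m → a (suc (m + d)) ≤ T * a m)
  (b-delay : ∀ m → suc Q * (σ * b (m + d)) ≤ suc Q * b (suc (m + d)) + Q * b m)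
  (initial : ∀ n → n < d → b n * a (suc n) ≤ b (suc n) * a n)
  (a≤b : a d ≤ b d)
  where

  M : ℕ
  M = suc Q * T

  instance
    M≢0 : NonZero M
    M≢0 = m*n≢0 (suc Q) T {{_}} {{m*n≢0⇒m≢0 T {{>-nonZero (≤-trans (a-pos (suc d)) (a-growth 0))}}}}

  _≼_ : ℕ → ℕ → Set
  i ≼ j = b i * a j ≤ b j * a i

  ≼-trans : ∀ {i j l} → i ≼ j → j ≼ l → i ≼ l
  ≼-trans {i} {j} {l} i≼j j≼l = *-cancelʳ-≤ (b i * a l) (b l * a i) (a j) {{>-nonZero (a-pos j)}} (begin
    b i * a l * a j    ≡⟨ swap₂ (b i) (a l) (a j) ⟩
    b i * a j * a l    ≤⟨ *-monoˡ-≤ (a l) i≼j ⟩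
    b j * a i * a l    ≡⟨ swap₂ (b j) (a i) (a l) ⟩
    b j * a l * a i    ≤⟨ *-monoˡ-≤ (a i) j≼l ⟩
    b l * a j * a i    ≡⟨ swap₂ (b l) (a j) (a i) ⟩
    b l * a i * a j    ∎)
    where
    open ≤-Reasoning
    swap₂ : ∀ x y z → x * y * z ≡ x * z * y
    swap₂ = solve-∀

  ≼-chain : ∀ i e → (∀ j → i ≤ j → j < i + e → j ≼ suc j) → i ≼ (i + e)
  ≼-chain i zero    _    rewrite +-identityʳ i = ≤-refl
  ≼-chain i (suc e) step rewrite +-suc i e =
    ≼-trans (≼-chain i e (λ j i≤j j<i+e → step j i≤j (m<n⇒m<1+n j<i+e))) (step (i + e) (m≤m+n i e) (n<1+n (i + e)))

  strict-step : ∀ m → m ≼ (m + d) → suc M * b (m + d) * a (suc (m + d)) ≤ M * b (suc (m + d)) * a (m + d)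
  strict-step m m≼ = ratio-step σ Q T (b (m + d)) (a (m + d)) (b (suc (m + d))) (a (suc (m + d))) (b m) (a m)
                       (b-delay m) (a-delay m) (a-growth m) m≼

  ≼-suc-delayed : ∀ m → m ≼ (m + d) → (m + d) ≼ suc (m + d)
  ≼-suc-delayed m m≼ = *-cancelˡ-≤ M (begin
    M * (X * Y′)             ≤⟨ m≤m+n _ _ ⟩
    M * (X * Y′) + X * Y′    ≡⟨ expand M X Y′ ⟨
    suc M * X * Y′           ≤⟨ strict-step m m≼ ⟩
    M * X′ * Y               ≡⟨ *-assoc M X′ Y ⟩
    M * (X′ * Y)             ∎)
    where
    open ≤-Reasoning
    X = b (m + d)
    Y = a (m + d)
    X′ = b (suc (m + d))
    Y′ = a (suc (m + d))
    expand : ∀ M X Y → suc M * X * Y ≡ M * (X * Y) + X * Y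
    expand = solve-∀

  ≼-suc : ∀ n → n ≼ suc n
  ≼-suc = <-rec (λ n → n ≼ suc n) step
    where
    step : ∀ n → (∀ {j} → j < n → j ≼ suc j) → n ≼ suc n
    step n rec with n <? d
    ... | yes n<d = initial n n<d
    ... | no n≮d  = subst (λ i → i ≼ suc i) m+d≡n
          (≼-suc-delayed m (≼-chain m d (λ j _ j<m+d → rec (subst (j <_) m+d≡n j<m+d))))
      where
      m = n ∸ d
      m+d≡n : m + d ≡ n
      m+d≡n = m∸n+n≡m (≮⇒≥ n≮d)

  ratio-growth : ∀ j → (M + j) * a (j + d) ≤ M * b (j + d)
  ratio-growth zero = subst (λ x → x * a d ≤ M * b d) (sym (+-identityʳ M)) (*-monoʳ-≤ M a≤b)
  ratio-growth (suc j) = *-cancelʳ-≤ _ _ (M * Y) {{m*n≢0 M Y {{M≢0}} {{>-nonZero (a-pos n)}}}} (begin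
    (M + suc j) * Y′ * (M * Y)         ≡⟨ regroup₁ M j Y′ Y ⟩
    M * (M + suc j) * (Y′ * Y)         ≤⟨ *-monoˡ-≤ (Y′ * Y) (≤-trans (m≤m+n _ j) (≤-reflexive (regroup₂ M j))) ⟩
    suc M * (M + j) * (Y′ * Y)         ≡⟨ regroup₃ M j Y′ Y ⟩
    suc M * Y′ * ((M + j) * Y)         ≤⟨ *-monoʳ-≤ (suc M * Y′) (ratio-growth j) ⟩
    suc M * Y′ * (M * X)               ≡⟨ regroup₄ M Y′ X ⟩
    M * (suc M * X * Y′)               ≤⟨ *-monoʳ-≤ M (strict-step j (≼-chain j d (λ i _ _ → ≼-suc i))) ⟩
    M * (M * X′ * Y)                   ≡⟨ regroup₅ M X′ Y ⟩
    M * X′ * (M * Y)                   ∎)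
    where
    open ≤-Reasoning
    n = j + d
    X = b n
    Y = a n
    X′ = b (suc n)
    Y′ = a (suc n)
    regroup₁ : ∀ M j Y′ Y → (M + suc j) * Y′ * (M * Y) ≡ M * (M + suc j) * (Y′ * Y)
    regroup₁ = solve-∀
    regroup₂ : ∀ M j → M * (M + suc j) + j ≡ suc M * (M + j)
    regroup₂ = solve-∀
    regroup₃ : ∀ M j Y′ Y → suc M * (M + j) * (Y′ * Y) ≡ suc M * Y′ * ((M + j) * Y)
    regroup₃ = solve-∀
    regroup₄ : ∀ M Y′ X → suc M * Y′ * (M * X) ≡ M * (suc M * X * Y′)
    regroup₄ = solve-∀
    regroup₅ : ∀ M X′ Y → M * (M * X′ * Y) ≡ M * X′ * (M * Y)
    regroup₅ = solve-∀

  eventually-dominates : ∀ c → ∃ λ n₀ → ∀ n → n₀ ≤ n → c * a n < b n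
  eventually-dominates c = M * c + d , dominates
    where
    dominates : ∀ n → M * c + d ≤ n → c * a n < b n
    dominates n n≥ = *-cancelˡ-≤ M (begin
      M * suc (c * a n)        ≡⟨ *-distribˡ-+ M 1 (c * a n) ⟩
      M * 1 + M * (c * a n)    ≤⟨ +-mono-≤ (*-monoʳ-≤ M (a-pos n)) (≤-reflexive (sym (*-assoc M c (a n)))) ⟩
      M * a n + M * c * a n    ≡⟨ *-distribʳ-+ (a n) M (M * c) ⟨
      (M + M * c) * a n        ≤⟨ *-monoˡ-≤ (a n) (+-monoʳ-≤ M j≥) ⟩
      (M + j) * a n            ≡⟨ cong (λ i → (M + j) * a i) j+d≡n ⟨
      (M + j) * a (j + d)      ≤⟨ ratio-growth j ⟩
      M * b (j + d)            ≡⟨ cong (λ i → M * b i) j+d≡n ⟩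
      M * b n                  ∎)
      where
      open ≤-Reasoning
      j = n ∸ d
      j+d≡n : j + d ≡ n
      j+d≡n = m∸n+n≡m (≤-trans (m≤n+m d (M * c)) n≥)
      j≥ : M * c ≤ j
      j≥ = subst (_≤ j) (m+n∸n≡m (M * c) d) (∸-monoˡ-≤ d n≥)

-- A periodic k-mer is avoided by many more strings than an aperiodic one

module _ {σ : ℕ} (2≤σ : 2 ≤ σ) (d : ℕ) (r p : Word σ) (|r|≡k : length r ≡ suc d) (|p|≡k : length p ≡ suc d)
         (r-aperiodic : ¬ Σ ℕ (IsPeriod r)) (q : ℕ) (p-period : IsPeriod p q) where

  private
    k P : ℕ
    k = suc d
    P = σ ^ q

    instance
      σ≢0 : NonZero σ
      σ≢0 = >-nonZero (≤-trans (s≤s z≤n) 2≤σ)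

    a bb f : ℕ → ℕ
    a  = #avoiding k r
    bb = #avoiding k p
    f  = #soleAtEnd k p

    q≤d : q ≤ d
    q≤d = ≤-pred (subst (q <_) |p|≡k (proj₁ (proj₂ p-period)))

    c-r : ∃ λ c → ∀ u → r ≢ u ∷ʳ c
    c-r = non-final-letter 2≤σ r

    c-p : ∃ λ c → ∀ u → p ≢ u ∷ʳ c
    c-p = non-final-letter 2≤σ p

    -- B n is P·A_p(n) + P·A_p(n ∸ q), except that σ^(q ⊓ n) replaces P so that B n = (P+1)σⁿ for
    -- n < k, as Domination requires.  By the periodic overlap bound, B satisfies the recurrence of A_r
    -- with the delayed term weighted by P/(P+1).
    B : ℕ → ℕ
    B n = P * bb n + σ ^ (q ⊓ n) * bb (n ∸ q)

    B-short : ∀ n → n < k → B n ≡ suc P * σ ^ n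
    B-short n n<k = begin
      P * bb n + σ ^ (q ⊓ n) * bb (n ∸ q)
        ≡⟨ cong₂ (λ x y → P * x + σ ^ (q ⊓ n) * y)
                 (#avoiding-short k p n n<k) (#avoiding-short k p (n ∸ q) (≤-<-trans (m∸n≤m n q) n<k)) ⟩
      P * σ ^ n + σ ^ (q ⊓ n) * σ ^ (n ∸ q)
        ≡⟨ cong (P * σ ^ n +_) (^-distribˡ-+-* σ (q ⊓ n) (n ∸ q)) ⟨
      P * σ ^ n + σ ^ (q ⊓ n + (n ∸ q))
        ≡⟨ cong (λ i → P * σ ^ n + σ ^ i) (m⊓n+n∸m≡n q n) ⟩
      P * σ ^ n + σ ^ n
        ≡⟨ +-comm (P * σ ^ n) (σ ^ n) ⟩
      suc P * σ ^ n ∎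
      where open ≡-Reasoning

    avoiding≤B : ∀ m → suc P * bb m ≤ B m
    avoiding≤B m = begin
      suc P * bb m      ≡⟨ +-comm (bb m) (P * bb m) ⟩
      P * bb m + bb m   ≤⟨ +-monoʳ-≤ (P * bb m) bb≤ ⟩
      B m               ∎
      where
      open ≤-Reasoning
      m∸q+q⊓m≡m : m ∸ q + q ⊓ m ≡ m
      m∸q+q⊓m≡m = trans (+-comm (m ∸ q) (q ⊓ m)) (m⊓n+n∸m≡n q m)
      bb≤ : bb m ≤ σ ^ (q ⊓ m) * bb (m ∸ q)
      bb≤ = subst (λ i → bb i ≤ σ ^ (q ⊓ m) * bb (m ∸ q)) m∸q+q⊓m≡m (#avoiding-+-≤ k p (m ∸ q) (q ⊓ m))

    B≤avoiding : ∀ n → B n ≤ (P + P) * bb n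
    B≤avoiding n = begin
      P * bb n + σ ^ (q ⊓ n) * bb (n ∸ q)
        ≤⟨ +-monoʳ-≤ (P * bb n)
             (*-mono-≤ (^-monoʳ-≤ σ (m⊓n≤m q n)) (#avoiding-monotone k p (proj₁ c-p) (proj₂ c-p) (m∸n≤m n q))) ⟩
      P * bb n + P * bb n
        ≡⟨ *-distribʳ-+ (bb n) P P ⟨
      (P + P) * bb n ∎
      where open ≤-Reasoning

    sole-pair≤avoiding : ∀ m → f (m + k) + f (m + k ∸ q) ≤ bb m
    sole-pair≤avoiding m with q ≤? m
    ... | yes q≤m = subst₂ (λ i j → f (i + k) + f j ≤ bb i) j+q≡m (sym (+-∸-comm k q≤m))
                      (#soleAtEnd-periodic k p |p|≡k q p-period j)
      where
      j = m ∸ q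
      j+q≡m : j + q ≡ m
      j+q≡m = m∸n+n≡m q≤m
    ... | no q≰m = begin
      f (m + k) + f (m + k ∸ q)
        ≡⟨ cong (f (m + k) +_) (#soleAtEnd-short k p _ (m<n+o⇒m∸n<o (m + k) q (+-monoˡ-< k (≰⇒> q≰m)))) ⟩
      f (m + k) + 0
        ≡⟨ +-identityʳ _ ⟩
      f (m + k)
        ≤⟨ #soleAtEnd≤#avoiding k p m ⟩
      bb m ∎
      where open ≤-Reasoning

    σB-step : ∀ n → q ≤ n → σ * B n ≡ B (suc n) + P * (f (suc n) + f (suc n ∸ q))
    σB-step n q≤n = begin
      σ * (P * bb n + σ ^ (q ⊓ n) * bb (n ∸ q))
        ≡⟨ cong (λ i → σ * (P * bb n + σ ^ i * bb (n ∸ q))) (m≤n⇒m⊓n≡m q≤n) ⟩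
      σ * (P * bb n + P * bb (n ∸ q))
        ≡⟨ distrib σ P (bb n) (bb (n ∸ q)) ⟩
      P * (σ * bb n) + P * (σ * bb (n ∸ q))
        ≡⟨ cong₂ (λ x y → P * x + P * y) (#avoiding-suc k p n) (#avoiding-suc k p (n ∸ q)) ⟨
      P * (bb (suc n) + f (suc n)) + P * (bb (suc (n ∸ q)) + f (suc (n ∸ q)))
        ≡⟨ regroup P (bb (suc n)) (f (suc n)) _ _ ⟩
      P * bb (suc n) + P * bb (suc (n ∸ q)) + P * (f (suc n) + f (suc (n ∸ q)))
        ≡⟨ cong₂ (λ i j → P * bb (suc n) + σ ^ i * bb j + P * (f (suc n) + f j))
                 (m≤n⇒m⊓n≡m (m≤n⇒m≤1+n q≤n)) (+-∸-assoc 1 q≤n) ⟨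
      B (suc n) + P * (f (suc n) + f (suc n ∸ q)) ∎
      where
      open ≡-Reasoning
      distrib : ∀ σ P x y → σ * (P * x + P * y) ≡ P * (σ * x) + P * (σ * y)
      distrib = solve-∀
      regroup : ∀ P x y x′ y′ → P * (x + y) + P * (x′ + y′) ≡ P * x + P * x′ + P * (y + y′)
      regroup = solve-∀

    B-delay : ∀ m → suc P * (σ * B (m + d)) ≤ suc P * B (suc (m + d)) + P * B m
    B-delay m = begin
      suc P * (σ * B n)
        ≡⟨ cong (suc P *_) (σB-step n (≤-trans q≤d (m≤n+m d m))) ⟩
      suc P * (B (suc n) + P * (f (suc n) + f (suc n ∸ q)))
        ≤⟨ *-monoʳ-≤ (suc P) (+-monoʳ-≤ (B (suc n)) (*-monoʳ-≤ P
             (subst (λ i → f i + f (i ∸ q) ≤ bb m) (+-suc m d) (sole-pair≤avoiding m)))) ⟩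
      suc P * (B (suc n) + P * bb m)
        ≡⟨ distrib (suc P) (B (suc n)) P (bb m) ⟩
      suc P * B (suc n) + P * (suc P * bb m)
        ≤⟨ +-monoʳ-≤ (suc P * B (suc n)) (*-monoʳ-≤ P (avoiding≤B m)) ⟩
      suc P * B (suc n) + P * B m ∎
      where
      open ≤-Reasoning
      n = m + d
      distrib : ∀ P′ x P y → P′ * (x + P * y) ≡ P′ * x + P * (P′ * y)
      distrib = solve-∀

    B-initial : ∀ n → n < d → B n * a (suc n) ≤ B (suc n) * a n
    B-initial n n<d = ≤-reflexive (begin
      B n * a (suc n)
        ≡⟨ cong₂ _*_ (B-short n (m<n⇒m<1+n n<d)) (#avoiding-short k r (suc n) (s≤s n<d)) ⟩
      suc P * σ ^ n * σ ^ suc n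
        ≡⟨ commute (suc P) σ (σ ^ n) ⟩
      suc P * σ ^ suc n * σ ^ n
        ≡⟨ cong₂ _*_ (B-short (suc n) (s≤s n<d)) (#avoiding-short k r n (m<n⇒m<1+n n<d)) ⟨
      B (suc n) * a n ∎)
      where
      open ≡-Reasoning
      commute : ∀ x σ y → x * y * (σ * y) ≡ x * (σ * y) * y
      commute = solve-∀

    a≤B : a d ≤ B d
    a≤B = begin
      a d               ≡⟨ #avoiding-short k r d (n<1+n d) ⟩
      σ ^ d             ≤⟨ m≤m+n (σ ^ d) (P * σ ^ d) ⟩
      suc P * σ ^ d     ≡⟨ B-short d (n<1+n d) ⟨
      B d               ∎
      where open ≤-Reasoning

    a-delay : ∀ m → a (suc (m + d)) + a m ≤ σ * a (m + d)
    a-delay m = ≤-reflexive (begin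
      a (suc (m + d)) + a m
        ≡⟨ cong (a (suc (m + d)) +_) (#soleAtEnd-aperiodic k r |r|≡k r-aperiodic m) ⟨
      a (suc (m + d)) + #soleAtEnd k r (m + k)
        ≡⟨ cong (λ i → a (suc (m + d)) + #soleAtEnd k r i) (+-suc m d) ⟩
      a (suc (m + d)) + #soleAtEnd k r (suc (m + d))
        ≡⟨ #avoiding-suc k r (m + d) ⟩
      σ * a (m + d) ∎)
      where open ≡-Reasoning

    a-growth : ∀ m → a (suc (m + d)) ≤ σ ^ k * a m
    a-growth m = subst (λ i → a i ≤ σ ^ k * a m) (+-suc m d) (#avoiding-+-≤ k r m k)

    open Domination σ d P (σ ^ k) a B (#avoiding-pos k r (proj₁ c-r) (proj₂ c-r)) a-delay a-growth B-delay B-initial a≤B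
      using (eventually-dominates)

  avoiding-domination : ∀ C → ∃ λ n₀ → ∀ n → n₀ ≤ n → C * #avoiding k r n < #avoiding k p n
  avoiding-domination C with n₀ , dominates ← eventually-dominates ((P + P) * C) =
    n₀ , λ n n≥n₀ → *-cancelˡ-< (P + P) _ _ (begin-strict
      (P + P) * (C * a n)        ≡⟨ *-assoc (P + P) C (a n) ⟨
      (P + P) * C * a n          <⟨ dominates n n≥n₀ ⟩
      B n                        ≤⟨ B≤avoiding n ⟩
      (P + P) * bb n             ∎)
    where open ≤-Reasoning

-- Charged strings and densities

#startsWith : ∀ {σ k} (w : Word σ) → length w ≡ k → ∀ m → countWords (m + k) (startsWith k w) ≡ σ ^ m
#startsWith {σ} {k} w |w|≡k m = ≤-antisym
  (≤-trans (countWords-injection (drop k)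
     (λ {v} (len , _) → trans (length-drop k v) (trans (cong (_∸ k) len) (m+n∸n≡m m k)) , refl)
     (λ {u} {v} (_ , su) (_ , sv) eq → begin
       u                   ≡⟨ split u su ⟩
       w ++ drop k u       ≡⟨ cong (w ++_) eq ⟩
       w ++ drop k v       ≡⟨ split v sv ⟨
       v                   ∎))
   (≤-reflexive (countWords-all m)))
  (≤-trans (≤-reflexive (sym (countWords-all m))) (countWords-injection (w ++_)
     (λ {v} (len , _) → trans (length-++ w) (trans (cong₂ _+_ |w|≡k len) (+-comm k m)) ,
                        ≡⇒⌊≟w⌋ (sym (trans (cong (λ i → take i (w ++ v)) (sym |w|≡k)) (take-length-++ w v))))
     (λ {u} {v} _ _ → ++-cancelˡ w u v)))
  where
  open ≡-Reasoning
  split : ∀ v → startsWith k w v ≡ true → v ≡ w ++ drop k v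
  split v s = trans (sym (take++drop≡id k v)) (cong (_++ drop k v) (sym (⌊≟w⌋⇒≡ s)))

module _ {σ k : ℕ} .{{_ : NonZero k}} (r : Kmer σ k) (ρ : Arrangement σ k) where

  private
    w = toList r

  charged-occurring : ∀ v → 0 < occ k w v →
    charged (r ∷ ρ) v ≡ startsWith k w v ∨ (⌊ w ≟w suffix k v ⌋ ∧ (occ k w v ≡ᵇ 1))
  charged-occurring v occ>0 rewrite T⇒≡true (<⇒<ᵇ occ>0) = refl

  charged⇒ : ∀ v → k ≤ length v → charged (r ∷ ρ) v ≡ true →
    startsWith k w v ∨ (soleAtEnd k w v ∨ avoids k w v) ≡ true
  charged⇒ v k≤ ch with occ k w v ≟ 0
  ... | yes occ≡0 = trans (cong (λ b → startsWith k w v ∨ (soleAtEnd k w v ∨ b)) (avoids⁺ k w occ≡0))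
                          (trans (cong (startsWith k w v ∨_) (∨-zeroʳ _)) (∨-zeroʳ _))
  ... | no occ≢0 with startsWith k w v | charged-occurring v (n≢0⇒n>0 occ≢0)
  ...   | true  | _  = refl
  ...   | false | eq with Equivalence.to T-∧ (≡true⇒T (trans (sym eq) ch))
  ...     | w≡s , once = cong (_∨ avoids k w v) (soleAtEnd⁺ k w k≤ (sym (⌊≟w⌋⇒≡ (T⇒≡true w≡s))) (≡ᵇ⇒≡ _ 1 once))

  startsWith∧soleAtEnd : ∀ v → k < length v → startsWith k w v ∧ soleAtEnd k w v ≡ false
  startsWith∧soleAtEnd v k<v with startsWith k w v in s | soleAtEnd k w v in sole
  ... | false | _     = refl
  ... | true  | false = refl
  ... | true  | true  = contradiction (begin
        1                     ≡⟨ occ-self k w (length-toList r) ⟨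
        occ k w w             ≡⟨ cong (occ k w) (⌊≟w⌋⇒≡ s) ⟩
        occ k w (take k v)    ≡⟨ soleAtEnd-prefix-avoids k w k sole k<v ⟩
        0                     ∎) λ ()
    where open ≡-Reasoning

  ⇒charged : ∀ v → startsWith k w v ∨ soleAtEnd k w v ≡ true → charged (r ∷ ρ) v ≡ true
  ⇒charged v hit with startsWith k w v in s
  ... | true = trans (charged-occurring v occ>0) (cong (_∨ (⌊ w ≟w suffix k v ⌋ ∧ (occ k w v ≡ᵇ 1))) s)
    where
    occ>0 : 0 < occ k w v
    occ>0 = begin
      1                     ≡⟨ occ-self k w (length-toList r) ⟨
      occ k w w             ≡⟨ cong (occ k w) (⌊≟w⌋⇒≡ s) ⟩
      occ k w (take k v)    ≤⟨ occ-take-≤ k w k v ⟩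
      occ k w v             ∎
      where open ≤-Reasoning
  ... | false with k≤ , s≡w , once ← soleAtEnd⁻ k w hit = begin
    charged (r ∷ ρ) v
      ≡⟨ charged-occurring v (subst (0 <_) (sym once) (s≤s z≤n)) ⟩
    startsWith k w v ∨ (⌊ w ≟w suffix k v ⌋ ∧ (occ k w v ≡ᵇ 1))
      ≡⟨ cong₂ (λ b i → b ∨ (⌊ w ≟w suffix k v ⌋ ∧ (i ≡ᵇ 1))) s once ⟩
    ⌊ w ≟w suffix k v ⌋ ∧ true
      ≡⟨ cong (_∧ true) (≡⇒⌊≟w⌋ (sym s≡w)) ⟩
    true ∎
    where open ≡-Reasoning

  #charged≤ : ∀ n → k ≤ n →
    countWords n (charged (r ∷ ρ)) ≤ countWords n (startsWith k w) + (#soleAtEnd k w n + #avoiding k w n)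
  #charged≤ n k≤n = begin
    countWords n (charged (r ∷ ρ))
      ≤⟨ countWords-mono (λ {v} len → charged⇒ v (subst (k ≤_) (sym len) k≤n)) ⟩
    countWords n (λ v → startsWith k w v ∨ (soleAtEnd k w v ∨ avoids k w v))
      ≤⟨ countWords-∨-≤ n _ _ ⟩
    countWords n (startsWith k w) + countWords n (λ v → soleAtEnd k w v ∨ avoids k w v)
      ≤⟨ +-monoʳ-≤ (countWords n (startsWith k w)) (countWords-∨-≤ n _ _) ⟩
    countWords n (startsWith k w) + (#soleAtEnd k w n + #avoiding k w n) ∎
    where open ≤-Reasoning

  #charged≥ : ∀ n → k < n → countWords n (startsWith k w) + #soleAtEnd k w n ≤ countWords n (charged (r ∷ ρ))
  #charged≥ n k<n = begin
    countWords n (startsWith k w) + #soleAtEnd k w n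
      ≡⟨ countWords-∨-disjoint n _ _ (λ v len → startsWith∧soleAtEnd v (subst (k <_) (sym len) k<n)) ⟨
    countWords n (λ v → startsWith k w v ∨ soleAtEnd k w v)
      ≤⟨ countWords-mono (λ {v} _ → ⇒charged v) ⟩
    countWords n (charged (r ∷ ρ)) ∎
    where open ≤-Reasoning

  #charged≤#avoiding : ∀ m →
    countWords (m + k + k) (charged (r ∷ ρ)) ≤ σ ^ (m + k) + (σ ^ k + σ ^ k * σ ^ k) * #avoiding k w m
  #charged≤#avoiding m = begin
    countWords (m + k + k) (charged (r ∷ ρ))
      ≤⟨ #charged≤ (m + k + k) (m≤n+m k (m + k)) ⟩
    countWords (m + k + k) (startsWith k w) + (#soleAtEnd k w (m + k + k) + #avoiding k w (m + k + k))
      ≡⟨ cong (_+ (#soleAtEnd k w (m + k + k) + #avoiding k w (m + k + k))) (#startsWith w (length-toList r) (m + k)) ⟩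
    σ ^ (m + k) + (#soleAtEnd k w (m + k + k) + #avoiding k w (m + k + k))
      ≤⟨ +-monoʳ-≤ (σ ^ (m + k)) (+-monoˡ-≤ _ (#soleAtEnd≤#avoiding k w (m + k))) ⟩
    σ ^ (m + k) + (#avoiding k w (m + k) + #avoiding k w (m + k + k))
      ≤⟨ +-monoʳ-≤ (σ ^ (m + k)) (+-mono-≤ (#avoiding-+-≤ k w m k) two-steps) ⟩
    σ ^ (m + k) + (σ ^ k * #avoiding k w m + σ ^ k * σ ^ k * #avoiding k w m)
      ≡⟨ cong (σ ^ (m + k) +_) (*-distribʳ-+ (#avoiding k w m) (σ ^ k) _) ⟨
    σ ^ (m + k) + (σ ^ k + σ ^ k * σ ^ k) * #avoiding k w m ∎
    where
    open ≤-Reasoning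
    two-steps : #avoiding k w (m + k + k) ≤ σ ^ k * σ ^ k * #avoiding k w m
    two-steps = subst₂ (λ i j → #avoiding k w i ≤ j * #avoiding k w m) (sym (+-assoc m k k)) (^-distribˡ-+-* σ k k)
                  (#avoiding-+-≤ k w m (k + k))

  #avoiding≤#charged : 2 ≤ σ → ∀ m → σ ^ (m + k) + #avoiding k w m ≤ countWords (m + k + k) (charged (r ∷ ρ))
  #avoiding≤#charged 2≤σ m = begin
    σ ^ (m + k) + #avoiding k w m
      ≤⟨ +-monoʳ-≤ (σ ^ (m + k)) (#avoiding≤#soleAtEnd-padded k w c c-not-last (length-toList r) m) ⟩
    σ ^ (m + k) + #soleAtEnd k w (m + k + k)
      ≡⟨ cong (_+ #soleAtEnd k w (m + k + k)) (#startsWith w (length-toList r) (m + k)) ⟨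
    countWords (m + k + k) (startsWith k w) + #soleAtEnd k w (m + k + k)
      ≤⟨ #charged≥ (m + k + k) (m<n+m k (≤-trans (>-nonZero⁻¹ k) (m≤n+m k m))) ⟩
    countWords (m + k + k) (charged (r ∷ ρ)) ∎
    where
    open ≤-Reasoning
    c : Fin σ
    c = proj₁ (non-final-letter 2≤σ w)
    c-not-last : ∀ u → w ≢ u ∷ʳ c
    c-not-last = proj₂ (non-final-letter 2≤σ w)

charged-gap : ∀ {σ} d → 2 ≤ σ → (r p : Kmer σ (suc d)) (ρ π : Arrangement σ (suc d)) →
  ¬ HasPeriod r → HasPeriod p →
  ∃ λ w₀ → ∀ w → w₀ ≤ w → countWords (w + suc d) (charged (r ∷ ρ)) < countWords (w + suc d) (charged (p ∷ π))
charged-gap {σ} d 2≤σ r p ρ π r-aperiodic (q , p-period) = n₀ + k , gap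
  where
  k : ℕ
  k = suc d
  C : ℕ
  C = σ ^ k + σ ^ k * σ ^ k
  domination : ∃ λ n₀ → ∀ n → n₀ ≤ n → C * #avoiding k (toList r) n < #avoiding k (toList p) n
  domination = avoiding-domination 2≤σ d (toList r) (toList p) (length-toList r) (length-toList p) r-aperiodic q p-period C
  n₀ : ℕ
  n₀ = proj₁ domination
  gap : ∀ w → n₀ + k ≤ w → countWords (w + k) (charged (r ∷ ρ)) < countWords (w + k) (charged (p ∷ π))
  gap w w≥ = subst (λ i → countWords (i + k) (charged (r ∷ ρ)) < countWords (i + k) (charged (p ∷ π))) m+k≡w
    (begin-strict
    countWords (m + k + k) (charged (r ∷ ρ))
      ≤⟨ #charged≤#avoiding r ρ m ⟩
    σ ^ (m + k) + C * #avoiding k (toList r) m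
      <⟨ +-monoʳ-< (σ ^ (m + k)) (proj₂ domination m (subst (_≤ m) (m+n∸n≡m n₀ k) (∸-monoˡ-≤ k w≥))) ⟩
    σ ^ (m + k) + #avoiding k (toList p) m
      ≤⟨ #avoiding≤#charged p π 2≤σ m ⟩
    countWords (m + k + k) (charged (p ∷ π)) ∎)
    where
    open ≤-Reasoning
    m = w ∸ k
    m+k≡w : m + k ≡ w
    m+k≡w = m∸n+n≡m (≤-trans (m≤n+m k n₀) w≥)

/-monoˡ-< : ∀ {a b} n .{{_ : NonZero n}} → a < b → (ℤ.+ a ℚ./ n) ℚ.< (ℤ.+ b ℚ./ n)
/-monoˡ-< {a} {b} (suc d) a<b = ℚ.toℚᵘ-cancel-<
  (ℚᵘ.<-respˡ-≃ (ℚᵘ.≃-sym (ℚ.toℚᵘ-fromℚᵘ (ℚᵘ.mkℚᵘ (ℤ.+ a) d)))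
  (ℚᵘ.<-respʳ-≃ (ℚᵘ.≃-sym (ℚ.toℚᵘ-fromℚᵘ (ℚᵘ.mkℚᵘ (ℤ.+ b) d)))
  (ℚᵘ.*<* (subst₂ ℤ._<_ (ℤ.pos-* a (suc d)) (ℤ.pos-* b (suc d)) (ℤ.+<+ (*-monoˡ-< (suc d) a<b))))))

counts⇒◁ : ∀ {σ k} {ρ π : Arrangement σ k} → 1 ≤ σ →
  (∃ λ w₀ → ∀ w → w₀ ≤ w → countWords (w + k) (charged ρ) < countWords (w + k) (charged π)) → ρ ◁ π
counts⇒◁ {suc s} {k} {ρ} {π} _ (w₀ , gap) = w₀ , λ w w≥w₀ →
  /-monoˡ-< (suc s ^ (w + k)) {{m^n≢0 (suc s) (w + k)}}
    (subst₂ _<_ (countWords-definition (w + k) (charged ρ)) (countWords-definition (w + k) (charged π)) (gap w w≥w₀))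

corollary13 : (σ k : ℕ) → 2 ≤ σ → 2 ≤ k →
    (π ρ : Arrangement σ k) → InU π → InU ρ →
    (r : Kmer σ k) → head ρ ≡ just r → ¬ HasPeriod r →
    (p : Kmer σ k) → head π ≡ just p →
    (HasPeriod p → ρ ◁ π) ×
    (¬ HasPeriod p → (n : ℕ) → CS p n ≡ CS r n)
corollary13 σ k _ _ []      _       _ _ _ _    _ _ ()
corollary13 σ k _ _ (_ ∷ _) []      _ _ _ ()   _ _ _
corollary13 σ (suc d) 2≤σ (s≤s _) (p ∷ π) (r ∷ ρ) _ _ .r refl r-aperiodic .p refl = part-i , part-ii
  where
  part-i : HasPeriod p → (r ∷ ρ) ◁ (p ∷ π)
  part-i p-periodic = counts⇒◁ (≤-trans (n≤1+n 1) 2≤σ) (charged-gap d 2≤σ r p ρ π r-aperiodic p-periodic)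

  part-ii : ¬ HasPeriod p → ∀ n → CS p n ≡ CS r n
  part-ii p-aperiodic n = begin
    CS p n
      ≡⟨ countWords-definition n (soleAtEnd (suc d) (toList p)) ⟨
    #soleAtEnd (suc d) (toList p) n
      ≡⟨ aperiodic-#soleAtEnd-agree (suc d) (toList p) (toList r) (length-toList p) (length-toList r)
                                                                      p-aperiodic r-aperiodic n ⟩
    #soleAtEnd (suc d) (toList r) n
      ≡⟨ countWords-definition n (soleAtEnd (suc d) (toList r)) ⟩
    CS r n ∎
    where open ≡-Reasoning
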